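{- Let $p$ be an odd prime and let $N$ be a subgroup of $\mathrm{PGL}_2(\mathbb{F}_p)$ isomorphic to $C_2\times C_2$, so that $N$ has three subgroups $C$ of index $2$. If $N\le \mathrm{PSL}_2(\mathbb{F}_p)$, then every such $C$ is contained in (the image of) a Cartan subgroup and $N$ in its normaliser, and each $C$ is split when $p\equiv1\pmod4$ and non-split when $p\equiv3\pmod4$. If $N\not\le\mathrm{PSL}_2(\mathbb{F}_p)$, then for $p\equiv1\pmod4$ one such subgroup $C$ is contained in a split Cartan subgroup while the other two are contained in non-split Cartan subgroups, while if $p\equiv3\pmod4$ then one $C$ is non-split and the other two are split.
   Context: Cartan subgroups of $\mathrm{GL}_2(\mathbb{F}_p)$ are split (conjugates of the diagonal subgroup) or non-split (conjugates of $\mathbb{F}_{p^2}^*$ acting on $\mathbb{F}_{p^2}\cong\mathbb{F}_p^2$); their images in $\mathrm{PGL}_2(\mathbb{F}_p)$ are called split/non-split Cartan subgroups there too. $\mathrm{PSL}_2(\mathbb{F}_p)$ is viewed as the index-2 subgroup of $\mathrm{PGL}_2(\mathbb{F}_p)$ of classes with square determinant. $C_2$ denotes the cyclic group of order 2. -}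

module Defs where

open import Data.Nat as ℕ using (ℕ)
open import Data.Integer using (ℤ; +_; _+_; _-_; _*_; -_)
open import Data.Integer.Divisibility using (_∣_)
open import Data.Product using (Σ; _×_; _,_)
open import Data.Sum using (_⊎_)
open import Relation.Nullary using (¬_)

-- The field F_p is modelled by ℤ with equality taken modulo p.
_≡_[mod_] : ℤ → ℤ → ℕ → Set
x ≡ y [mod p ] = (+ p) ∣ (x - y)

record Mat : Set where
  constructor mat
  field
    m₁₁ m₁₂ m₂₁ m₂₂ : ℤ
open Mat public

infixl 7 _·_
_·_ : Mat → Mat → Mat
mat a b c d · mat a' b' c' d' =
  mat (a * a' + b * c') (a * b' + b * d') (c * a' + d * c') (c * b' + d * d')

I₂ : Mat
I₂ = mat (+ 1) (+ 0) (+ 0) (+ 1)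

scal : ℤ → Mat → Mat
scal λ' (mat a b c d) = mat (λ' * a) (λ' * b) (λ' * c) (λ' * d)

det : Mat → ℤ
det (mat a b c d) = a * d - b * c

adj : Mat → Mat
adj (mat a b c d) = mat d (- b) (- c) a

_≋_[mod_] : Mat → Mat → ℕ → Set
m ≋ n [mod p ] =
  (m₁₁ m ≡ m₁₁ n [mod p ]) × (m₁₂ m ≡ m₁₂ n [mod p ]) ×
  (m₂₁ m ≡ m₂₁ n [mod p ]) × (m₂₂ m ≡ m₂₂ n [mod p ])

Inv : ℕ → Mat → Set
Inv p m = ¬ (+ p ∣ det m)

NonZero : ℕ → ℤ → Set
NonZero p x = ¬ (+ p ∣ x)

-- equality of the classes of m and n in PGL₂(F_p): m = λ n for some λ ∈ F_p^*
ProjEq : ℕ → Mat → Mat → Set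
ProjEq p m n = Σ ℤ λ λ' → NonZero p λ' × (m ≋ scal λ' n [mod p ])

-- the class of m lies in PSL₂(F_p): det m is a square in F_p
SqDet : ℕ → Mat → Set
SqDet p m = Σ ℤ λ s → det m ≡ s * s [mod p ]

NonSquare : ℕ → ℤ → Set
NonSquare p ε = NonZero p ε × ¬ (Σ ℤ λ s → ε ≡ s * s [mod p ])

diag : ℤ → ℤ → Mat
diag u v = mat u (+ 0) (+ 0) v

-- F_{p²}^* = F_p(√ε)^* acting on F_{p²} ≅ F_p² (basis 1, √ε): u + v√ε ↦ (u εv ; v u)
nsMat : ℤ → ℤ → ℤ → Mat
nsMat ε u v = mat u (ε * v) v u

-- Split Cartan subgroup g D g⁻¹ (D = invertible diagonal), as a predicate on GL₂
SplitCartan : ℕ → Mat → Mat → Set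
SplitCartan p g x = Inv p x × Σ ℤ λ u → Σ ℤ λ v → ((x · g) ≋ (g · diag u v) [mod p ])

-- Non-split Cartan subgroup g F_{p²}^* g⁻¹ (ε a non-square), as a predicate on GL₂
NonSplitCartan : ℕ → ℤ → Mat → Mat → Set
NonSplitCartan p ε g x = Inv p x × Σ ℤ λ u → Σ ℤ λ v → ((x · g) ≋ (g · nsMat ε u v) [mod p ])

-- y normalises T:  y T y⁻¹ ⊆ T   (y x adj(y) = det(y) · y x y⁻¹, and T is closed under F_p^*)
Normalises : ℕ → Mat → (Mat → Set) → Set
Normalises p y T = ∀ x → T x → T (y · x · adj y)

-- The subgroup C = ⟨[x]⟩ of PGL₂(F_p) lies in the image of a split / non-split Cartan
-- subgroup (Cartan subgroups contain the scalars, so this is just x ∈ T).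
InSplit : ℕ → Mat → Set
InSplit p x = Σ Mat λ g → Inv p g × SplitCartan p g x

InNonSplit : ℕ → Mat → Set
InNonSplit p x = Σ ℤ λ ε → NonSquare p ε × Σ Mat λ g → Inv p g × NonSplitCartan p ε g x

InSplitNorm : ℕ → Mat → Mat → Mat → Set
InSplitNorm p a b x = Σ Mat λ g → Inv p g × SplitCartan p g x ×
  Normalises p a (SplitCartan p g) × Normalises p b (SplitCartan p g)

InNonSplitNorm : ℕ → Mat → Mat → Mat → Set
InNonSplitNorm p a b x = Σ ℤ λ ε → NonSquare p ε × Σ Mat λ g → Inv p g ×
  NonSplitCartan p ε g x ×
  Normalises p a (NonSplitCartan p ε g) × Normalises p b (NonSplitCartan p ε g)

-- [a],[b] generate a subgroup N ≅ C₂ × C₂ of PGL₂(F_p): they are commuting involutions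
-- with [a], [b], [ab] pairwise distinct nontrivial classes.  N = {1,[a],[b],[ab]}; its three
-- index-2 subgroups are ⟨[a]⟩, ⟨[b]⟩, ⟨[ab]⟩.
KleinFour : ℕ → Mat → Mat → Set
KleinFour p a b =
  Inv p a × Inv p b ×
  ¬ ProjEq p a I₂ × ¬ ProjEq p b I₂ × ¬ ProjEq p (a · b) I₂ ×
  ProjEq p (a · a) I₂ × ProjEq p (b · b) I₂ × ProjEq p (a · b) (b · a)

OneTwo : (Mat → Set) → (Mat → Set) → Mat → Mat → Set
OneTwo P Q a b =
  (P a × Q b × Q (a · b)) ⊎ (Q a × P b × Q (a · b)) ⊎ (Q a × Q b × P (a · b))

{-# OPTIONS --safe #-}
-- A non-scalar m with [m]² = 1 in PGL₂(F_p) has trace 0, so m = (s t ; r -s) with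
-- m² = α I and α = s² + tr = -det m. If α is a nonzero square, m is diagonalisable with eigenvalues
-- ±√α; otherwise m acts as √α on F_p(√α) ≅ F_p². Either way the centraliser of m is a
-- split resp. non-split torus, and every n with [n][m] = [m][n] normalises it, since
-- conjugation by n sends m to a scalar multiple of itself. For m = a, b, ab the type is
-- thus the quadratic character of -det m = (-1)·det m with det ab = det a · det b, which
-- Euler's criterion settles: -1 is a square iff p ≡ 1 (mod 4), and the product of two
-- non-squares is a square. Euler's criterion comes from pairing each x ∈ F_p^* with c x⁻¹
-- in the product of all units, which equals -1 (Wilson).
module Submission where

open import Defs
open import Data.Nat as ℕ using (ℕ; zero; suc; _∸_; _%_; z≤n; s≤s)
import Data.Nat.Properties as ℕP
import Data.Nat.Divisibility as ℕD
open import Data.Nat.DivMod using (_/_; m≡m%n+[m/n]*n; m%n<n)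
open import Data.Nat.GCD using (module Bézout)
open import Data.Nat.Coprimality using (Coprime; coprime-Bézout)
open import Data.Nat.Primality using (Prime; euclidsLemma; prime⇒irreducible; prime⇒nonZero; prime⇒nonTrivial)
import Data.Nat.Tactic.RingSolver as ℕRing
open import Data.Integer as ℤ using (ℤ; +_; -[1+_]; _+_; _-_; _*_; -_; ∣_∣; _^_)
open import Data.Integer.DivMod using (_%ℕ_; _/ℕ_; n%ℕd<d; a≡a%ℕn+[a/ℕn]*n)
import Data.Integer.Properties as ℤP
import Data.Integer.Divisibility.Signed as ℤD
open import Data.Integer.Tactic.RingSolver using (solve-∀)
open import Data.List using (List; []; _∷_; foldr; length; filter; applyUpTo)
import Data.List.Properties as ListP
import Data.List.Membership.Setoid as Membership
import Data.List.Membership.Setoid.Properties as MembershipP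
import Data.List.Relation.Unary.Unique.Setoid as UniqueS
import Data.List.Relation.Unary.Unique.Setoid.Properties as UniqueP
open import Data.List.Relation.Unary.Any using (here; there)
import Data.List.Relation.Unary.All as All
open import Data.List.Relation.Unary.AllPairs using (_∷_)
open import Data.Product using (Σ; _×_; _,_; proj₁; proj₂)
open import Data.Sum using (_⊎_; inj₁; inj₂; [_,_]′)
open import Data.Empty using (⊥-elim)
open import Relation.Binary.Bundles using (Setoid)
import Relation.Binary.Reasoning.Setoid as SetoidReasoning
open import Relation.Binary.PropositionalEquality using (_≡_; _≢_; refl; sym; trans; cong; subst; module ≡-Reasoning)
open import Relation.Nullary using (¬_; Dec; yes; no; ¬?)
open import Relation.Nullary.Decidable using (decidable-stable)

module Residues (p : ℕ) (p-prime : Prime p) where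

  instance
    p-nonZero : ℕ.NonZero p
    p-nonZero = prime⇒nonZero p-prime

  Multiple : ℤ → Set
  Multiple x = + p ℤD.∣ x

  infixl 6 _⊕_
  infixr 7 _⊛_

  _⊕_ : ∀ {x y} → Multiple x → Multiple y → Multiple (x + y)
  _⊕_ = ℤD.∣m∣n⇒∣m+n

  _⊛_ : ∀ c {x} → Multiple x → Multiple (c * x)
  c ⊛ d = ℤD.∣n⇒∣m*n c d

  p-multiple : Multiple (+ p)
  p-multiple = ℤD.∣-refl

  -- A record rather than a definition, so that x and y can be inferred from a proof.
  infix 4 _≈_ _≉_ _≈?_
  record _≈_ (x y : ℤ) : Set where
    constructor mk≈
    field difference : Multiple (x - y)
  open _≈_ public

  _≉_ : ℤ → ℤ → Set
  x ≉ y = ¬ x ≈ y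

  -- Congruences are proved by writing x - y as an explicit ℤ-combination of known
  -- multiples of p; the polynomial identity is discharged by the ring solver.
  ≈-via : ∀ {x y e} → x - y ≡ e → Multiple e → x ≈ y
  ≈-via refl d = mk≈ d

  ≈-refl : ∀ {x} → x ≈ x
  ≈-refl {x} = ≈-via (ℤP.+-inverseʳ x) (ℤD.divides (+ 0) refl)

  ≈-reflexive : ∀ {x y} → x ≡ y → x ≈ y
  ≈-reflexive refl = ≈-refl

  ≈-sym : ∀ {x y} → x ≈ y → y ≈ x
  ≈-sym {x} {y} x≈y = ≈-via (identity x y) (- + 1 ⊛ difference x≈y)
    where identity : ∀ x y → y - x ≡ - + 1 * (x - y)
          identity = solve-∀

  ≈-trans : ∀ {x y z} → x ≈ y → y ≈ z → x ≈ z
  ≈-trans {x} {y} {z} x≈y y≈z = ≈-via (identity x y z) (difference x≈y ⊕ difference y≈z)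
    where identity : ∀ x y z → x - z ≡ (x - y) + (y - z)
          identity = solve-∀

  ≈-setoid : Setoid _ _
  ≈-setoid = record
    { Carrier = ℤ ; _≈_ = _≈_
    ; isEquivalence = record { refl = ≈-refl ; sym = ≈-sym ; trans = ≈-trans } }

  +-cong : ∀ {x y u v} → x ≈ y → u ≈ v → x + u ≈ y + v
  +-cong {x} {y} {u} {v} x≈y u≈v = ≈-via (identity x y u v) (difference x≈y ⊕ difference u≈v)
    where identity : ∀ x y u v → (x + u) - (y + v) ≡ (x - y) + (u - v)
          identity = solve-∀

  *-cong : ∀ {x y u v} → x ≈ y → u ≈ v → x * u ≈ y * v
  *-cong {x} {y} {u} {v} x≈y u≈v = ≈-via (identity x y u v) (u ⊛ difference x≈y ⊕ y ⊛ difference u≈v)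
    where identity : ∀ x y u v → x * u - y * v ≡ u * (x - y) + y * (u - v)
          identity = solve-∀

  -‿cong : ∀ {x y} → x ≈ y → - x ≈ - y
  -‿cong {x} {y} x≈y = ≈-via (identity x y) (- + 1 ⊛ difference x≈y)
    where identity : ∀ x y → - x - - y ≡ - + 1 * (x - y)
          identity = solve-∀

  -‿injective : ∀ {x y} → - x ≈ - y → x ≈ y
  -‿injective {x} {y} -x≈-y = ≈-via (identity x y) (- + 1 ⊛ difference -x≈-y)
    where identity : ∀ x y → x - y ≡ - + 1 * (- x - - y)
          identity = solve-∀

  ≈0⇒multiple : ∀ {x} → x ≈ + 0 → Multiple x
  ≈0⇒multiple {x} x≈0 = subst Multiple (ℤP.+-identityʳ x) (difference x≈0)

  multiple⇒≈0 : ∀ {x} → Multiple x → x ≈ + 0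
  multiple⇒≈0 {x} d = ≈-via (ℤP.+-identityʳ x) d

  ≡[mod]⇒≈ : ∀ {x y} → x ≡ y [mod p ] → x ≈ y
  ≡[mod]⇒≈ d = mk≈ (ℤD.∣ᵤ⇒∣ d)

  ≈⇒≡[mod] : ∀ {x y} → x ≈ y → x ≡ y [mod p ]
  ≈⇒≡[mod] x≈y = ℤD.∣⇒∣ᵤ (difference x≈y)

  nonZero⇒≉0 : ∀ {x} → NonZero p x → x ≉ + 0
  nonZero⇒≉0 nz x≈0 = nz (ℤD.∣⇒∣ᵤ (≈0⇒multiple x≈0))

  ≉0⇒nonZero : ∀ {x} → x ≉ + 0 → NonZero p x
  ≉0⇒nonZero x≉0 d = x≉0 (multiple⇒≈0 (ℤD.∣ᵤ⇒∣ d))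

  _≈?_ : ∀ x y → Dec (x ≈ y)
  x ≈? y with p ℕD.∣? ∣ x - y ∣
  ... | yes d = yes (mk≈ (ℤD.∣ᵤ⇒∣ d))
  ... | no ¬d = no λ x≈y → ¬d (ℤD.∣⇒∣ᵤ (difference x≈y))

  x*y≈0⇒x≈0⊎y≈0 : ∀ x y → x * y ≈ + 0 → x ≈ + 0 ⊎ y ≈ + 0
  x*y≈0⇒x≈0⊎y≈0 x y xy≈0
    with euclidsLemma ∣ x ∣ ∣ y ∣ p-prime
           (subst (p ℕD.∣_) (ℤP.abs-* x y) (ℤD.∣⇒∣ᵤ (≈0⇒multiple xy≈0)))
  ... | inj₁ p∣x = inj₁ (multiple⇒≈0 (ℤD.∣ᵤ⇒∣ p∣x))
  ... | inj₂ p∣y = inj₂ (multiple⇒≈0 (ℤD.∣ᵤ⇒∣ p∣y))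

  *-≉0 : ∀ {x y} → x ≉ + 0 → y ≉ + 0 → x * y ≉ + 0
  *-≉0 {x} {y} x≉0 y≉0 xy≈0 with x*y≈0⇒x≈0⊎y≈0 x y xy≈0
  ... | inj₁ x≈0 = x≉0 x≈0
  ... | inj₂ y≈0 = y≉0 y≈0

  -‿≉0 : ∀ {x} → x ≉ + 0 → - x ≉ + 0
  -‿≉0 x≉0 -x≈0 = x≉0 (-‿injective -x≈0)

  x*y≈0⇒y≈0 : ∀ {x y} → x ≉ + 0 → x * y ≈ + 0 → y ≈ + 0
  x*y≈0⇒y≈0 {x} {y} x≉0 xy≈0 with x*y≈0⇒x≈0⊎y≈0 x y xy≈0
  ... | inj₁ x≈0 = ⊥-elim (x≉0 x≈0)
  ... | inj₂ y≈0 = y≈0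

  factor-≉0 : ∀ {c} x y → c ≉ + 0 → x * y ≈ c → x ≉ + 0
  factor-≉0 x y c≉0 xy≈c x≈0 = c≉0 (≈-trans (≈-sym xy≈c) (≈-trans (*-cong x≈0 ≈-refl) (≈-reflexive (ℤP.*-zeroˡ y))))

  -x≈-1*x : ∀ x → - x ≈ - + 1 * x
  -x≈-1*x x = ≈-reflexive (sym (ℤP.-1*i≡-i x))

  ≉0-resp : ∀ {x y} → x ≈ y → y ≉ + 0 → x ≉ + 0
  ≉0-resp x≈y y≉0 x≈0 = y≉0 (≈-trans (≈-sym x≈y) x≈0)

  *-cancelˡ-≈ : ∀ {c x y} → c ≉ + 0 → c * x ≈ c * y → x ≈ y
  *-cancelˡ-≈ {c} {x} {y} c≉0 cx≈cy
    with x*y≈0⇒x≈0⊎y≈0 c (x - y) (≈-via (identity c x y) (difference cx≈cy))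
    where identity : ∀ c x y → c * (x - y) - + 0 ≡ c * x - c * y
          identity = solve-∀
  ... | inj₁ c≈0 = ⊥-elim (c≉0 c≈0)
  ... | inj₂ x-y≈0 = mk≈ (≈0⇒multiple x-y≈0)

  x*x≈y*y⇒x≈y⊎x≈-y : ∀ x y → x * x ≈ y * y → x ≈ y ⊎ x ≈ - y
  x*x≈y*y⇒x≈y⊎x≈-y x y xx≈yy
    with x*y≈0⇒x≈0⊎y≈0 (x - y) (x + y) (≈-via (identity x y) (difference xx≈yy))
    where identity : ∀ x y → (x - y) * (x + y) - + 0 ≡ x * x - y * y
          identity = solve-∀
  ... | inj₁ x-y≈0 = inj₁ (mk≈ (≈0⇒multiple x-y≈0))
  ... | inj₂ x+y≈0 = inj₂ (≈-via (identity x y) (≈0⇒multiple x+y≈0))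
    where identity : ∀ x y → x - - y ≡ x + y
          identity = solve-∀

  1<p : 1 ℕ.< p
  1<p = ℕ.nonTrivial⇒n>1 p {{prime⇒nonTrivial p-prime}}

  small-≉0 : ∀ {d} → 0 ℕ.< d → d ℕ.< p → + d ≉ + 0
  small-≉0 {d} 0<d d<p d≈0 =
    ℕP.<⇒≱ d<p (ℕD.∣⇒≤ {{ℕ.>-nonZero 0<d}} (ℤD.∣⇒∣ᵤ (≈0⇒multiple d≈0)))

  small-≉ : ∀ {i j} → i ℕ.< j → j ℕ.< p → + i ≉ + j
  small-≉ {i} {j} i<j j<p i≈j =
    small-≉0 (ℕP.m<n⇒0<n∸m i<j) (ℕP.≤-<-trans (ℕP.m∸n≤m j i) j<p)
      (≈-via j∸i-0≡j-i (- + 1 ⊛ difference i≈j))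
    where
    j∸i-0≡j-i : + (j ∸ i) - + 0 ≡ - + 1 * (+ i - + j)
    j∸i-0≡j-i = trans (ℤP.+-identityʳ _)
      (trans (sym (ℤP.⊖-≥ (ℕP.<⇒≤ i<j))) (trans (sym (ℤP.m-n≡m⊖n j i)) (identity (+ i) (+ j))))
      where identity : ∀ x y → y - x ≡ - + 1 * (x - y)
            identity = solve-∀

  1≉0 : + 1 ≉ + 0
  1≉0 = small-≉0 (s≤s z≤n) 1<p

  coprime-to-p : ∀ {n} → ¬ p ℕD.∣ n → Coprime n p
  coprime-to-p p∤n (d∣n , d∣p) with prime⇒irreducible p-prime d∣p
  ... | inj₁ d≡1 = d≡1
  ... | inj₂ refl = ⊥-elim (p∤n d∣n)

  pos-+-* : ∀ {a b c d e} → a ℕ.+ b ℕ.* c ≡ d ℕ.* e → + a + + b * + c ≡ + d * + e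
  pos-+-* {a} {b} {c} {d} {e} eq = begin
    + a + + b * + c    ≡⟨ cong (_+_ (+ a)) (sym (ℤP.pos-* b c)) ⟩
    + a + + (b ℕ.* c)  ≡⟨ sym (ℤP.pos-+ a (b ℕ.* c)) ⟩
    + (a ℕ.+ b ℕ.* c)  ≡⟨ cong +_ eq ⟩
    + (d ℕ.* e)        ≡⟨ ℤP.pos-* d e ⟩
    + d * + e          ∎
    where open ≡-Reasoning

  inverseℕ : ∀ n → ¬ p ℕD.∣ n → Σ ℤ λ m → + n * m ≈ + 1
  inverseℕ n p∤n with coprime-Bézout (coprime-to-p p∤n)
  ... | Bézout.+- x y eq = + x , ≈-via (begin
      + n * + x - + 1          ≡⟨ cong (_- + 1) (ℤP.*-comm (+ n) (+ x)) ⟩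
      + x * + n - + 1          ≡⟨ cong (_- + 1) (sym (pos-+-* {1} {y} {p} {x} {n} eq)) ⟩
      + 1 + + y * + p - + 1    ≡⟨ cancel-1 (+ y * + p) ⟩
      + y * + p                ∎) (+ y ⊛ p-multiple)
    where open ≡-Reasoning
          cancel-1 : ∀ a → + 1 + a - + 1 ≡ a
          cancel-1 = solve-∀
  ... | Bézout.-+ x y eq = - + x , ≈-via (begin
      + n * - + x - + 1        ≡⟨ negate (+ n) (+ x) ⟩
      - (+ 1 + + x * + n)      ≡⟨ cong -_ (pos-+-* {1} {x} {n} {y} {p} eq) ⟩
      - (+ y * + p)            ≡⟨ ℤP.neg-distribˡ-* (+ y) (+ p) ⟩
      - + y * + p              ∎) (- + y ⊛ p-multiple)
    where open ≡-Reasoning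
          negate : ∀ n x → n * - x - + 1 ≡ - (+ 1 + x * n)
          negate = solve-∀

  inverse : ∀ {x} → x ≉ + 0 → Σ ℤ λ y → x * y ≈ + 1
  inverse {+ n} x≉0 = inverseℕ n (λ p∣n → x≉0 (multiple⇒≈0 (ℤD.∣ᵤ⇒∣ p∣n)))
  inverse { -[1+ n ]} x≉0 with inverseℕ (suc n) (λ p∣n → x≉0 (multiple⇒≈0 (ℤD.∣ᵤ⇒∣ p∣n)))
  ... | y , ny≈1 = - y , ≈-trans (≈-reflexive (neg-neg (+ suc n) y)) ny≈1
    where neg-neg : ∀ a b → - a * - b ≡ a * b
          neg-neg = solve-∀

  residue : ∀ x → Σ ℕ λ k → k ℕ.< p × x ≈ + k
  residue x = x %ℕ p , n%ℕd<d x p , ≈-via (begin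
      x - + (x %ℕ p)                              ≡⟨ cong (_- + (x %ℕ p)) (a≡a%ℕn+[a/ℕn]*n x p) ⟩
      + (x %ℕ p) + (x /ℕ p) * + p - + (x %ℕ p)    ≡⟨ cancel (+ (x %ℕ p)) ((x /ℕ p) * + p) ⟩
      (x /ℕ p) * + p                              ∎) ((x /ℕ p) ⊛ p-multiple)
    where open ≡-Reasoning
          cancel : ∀ a b → a + b - a ≡ b
          cancel = solve-∀

  IsSquare : ℤ → Set
  IsSquare x = Σ ℤ λ s → x ≈ s * s

  IsNonSquare : ℤ → Set
  IsNonSquare x = x ≉ + 0 × ¬ IsSquare x

  IsNonSquare⇒NonSquare : ∀ {x} → IsNonSquare x → NonSquare p x
  IsNonSquare⇒NonSquare (x≉0 , x-nonsquare) = ≉0⇒nonZero x≉0 , λ (s , x≡ss) → x-nonsquare (s , ≡[mod]⇒≈ x≡ss)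

  square[mod]⇒IsSquare : ∀ {x} → Σ ℤ (λ s → x ≡ s * s [mod p ]) → IsSquare x
  square[mod]⇒IsSquare (s , x≡ss) = s , ≡[mod]⇒≈ x≡ss

  IsSquare⇒square[mod] : ∀ {x} → IsSquare x → Σ ℤ (λ s → x ≡ s * s [mod p ])
  IsSquare⇒square[mod] (s , x≈ss) = s , ≈⇒≡[mod] x≈ss

  IsSquare? : ∀ x → Dec (IsSquare x)
  IsSquare? x with ℕP.anyUpTo? (λ k → x ≈? + k * + k) p
  ... | yes (k , _ , x≈kk) = yes (+ k , x≈kk)
  ... | no ¬small = no λ (s , x≈ss) → let (k , k<p , s≈k) = residue s in
          ¬small (k , k<p , ≈-trans x≈ss (*-cong s≈k s≈k))

  IsSquare-resp : ∀ {x y} → x ≈ y → IsSquare y → IsSquare x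
  IsSquare-resp x≈y (s , y≈ss) = s , ≈-trans x≈y y≈ss

  IsNonSquare-resp : ∀ {x y} → x ≈ y → IsNonSquare y → IsNonSquare x
  IsNonSquare-resp x≈y (y≉0 , ¬□y) = ≉0-resp x≈y y≉0 , λ □x → ¬□y (IsSquare-resp (≈-sym x≈y) □x)

  square-≉0 : ∀ {x} s → x ≈ s * s → x ≉ + 0 → s ≉ + 0
  square-≉0 s x≈ss x≉0 s≈0 = x≉0 (≈-trans x≈ss (*-cong s≈0 s≈0))

module QuadraticResidues (p : ℕ) (p-prime : Prime p) (p≢2 : p ≢ 2) where
  open Residues p p-prime
  open Membership ≈-setoid using (_∈_; _∉_)
  open UniqueS ≈-setoid using (Unique)
  open SetoidReasoning ≈-setoid

  2≉0 : + 2 ≉ + 0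
  2≉0 2≈0 = p≢2 (ℕP.≤-antisym (ℕD.∣⇒≤ (ℤD.∣⇒∣ᵤ (≈0⇒multiple 2≈0))) 1<p)

  x≉-x : ∀ {x} → x ≉ + 0 → x ≉ - x
  x≉-x {x} x≉0 x≈-x with x*y≈0⇒x≈0⊎y≈0 (+ 2) x (≈-via (identity x) (difference x≈-x))
    where identity : ∀ x → + 2 * x - + 0 ≡ x - - x
          identity = solve-∀
  ... | inj₁ 2≈0 = 2≉0 2≈0
  ... | inj₂ x≈0 = x≉0 x≈0

  1≉-1 : + 1 ≉ - + 1
  1≉-1 = x≉-x 1≉0

  half-exists : Σ ℕ λ h → 2 ℕ.* h ≡ p ∸ 1
  half-exists with p % 2 | m%n<n p 2 | m≡m%n+[m/n]*n p 2
  ... | zero | _ | p≡q*2 with prime⇒irreducible p-prime (ℕD.divides (p / 2) p≡q*2)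
  ...   | inj₂ 2≡p = ⊥-elim (p≢2 (sym 2≡p))
  half-exists | suc zero | _ | p≡1+q*2 = p / 2 , trans (ℕP.*-comm 2 (p / 2)) (sym (cong (_∸ 1) p≡1+q*2))
  half-exists | suc (suc _) | s≤s (s≤s ()) | _

  half : ℕ
  half = proj₁ half-exists

  2*half≡p∸1 : 2 ℕ.* half ≡ p ∸ 1
  2*half≡p∸1 = proj₂ half-exists

  2*k≡p∸1⇒k≡half : ∀ {k} → 2 ℕ.* k ≡ p ∸ 1 → k ≡ half
  2*k≡p∸1⇒k≡half {k} 2k≡p∸1 = ℕP.*-cancelˡ-≡ k half 2 (trans 2k≡p∸1 (sym 2*half≡p∸1))

  ^-cong : ∀ {x y} n → x ≈ y → x ^ n ≈ y ^ n
  ^-cong zero _ = ≈-refl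
  ^-cong (suc n) x≈y = *-cong x≈y (^-cong n x≈y)

  ^-distribʳ-* : ∀ x y n → (x * y) ^ n ≡ x ^ n * y ^ n
  ^-distribʳ-* x y zero = refl
  ^-distribʳ-* x y (suc n) = trans (cong ((x * y) *_) (^-distribʳ-* x y n)) (interchange x y (x ^ n) (y ^ n))
    where interchange : ∀ a b c d → a * b * (c * d) ≡ a * c * (b * d)
          interchange = solve-∀

  prod : List ℤ → ℤ
  prod = foldr _*_ (+ 1)

  remove : ℤ → List ℤ → List ℤ
  remove y = filter (λ x → ¬? (x ≈? y))

  ≉-respˡ : ∀ {x x' y} → x ≈ x' → x ≉ y → x' ≉ y
  ≉-respˡ x≈x' x≉y x'≈y = x≉y (≈-trans x≈x' x'≈y)

  ∈-remove⁺ : ∀ {x y L} → x ∈ L → x ≉ y → x ∈ remove y L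
  ∈-remove⁺ {y = y} = MembershipP.∈-filter⁺ ≈-setoid (λ x → ¬? (x ≈? y)) ≉-respˡ

  ∈-remove⁻ : ∀ {x y L} → x ∈ remove y L → x ∈ L × x ≉ y
  ∈-remove⁻ {y = y} = MembershipP.∈-filter⁻ ≈-setoid (λ x → ¬? (x ≈? y)) ≉-respˡ

  remove-unique : ∀ {y L} → Unique L → Unique (remove y L)
  remove-unique {y} = UniqueP.filter⁺ ≈-setoid (λ x → ¬? (x ≈? y))

  prod-remove : ∀ {y L} → Unique L → y ∈ L →
                prod L ≈ y * prod (remove y L) × length L ≡ suc (length (remove y L))
  prod-remove {y} {x ∷ L} (x∉L ∷ _) _ with x ≈? y
  ... | yes x≈y rewrite ListP.filter-all (λ z → ¬? (z ≈? y)) (All.map (λ x≉z z≈y → x≉z (≈-trans x≈y (≈-sym z≈y))) x∉L)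
    = *-cong x≈y ≈-refl , refl
  prod-remove {y} {x ∷ L} _ (here y≈x) | no x≉y = ⊥-elim (x≉y (≈-sym y≈x))
  prod-remove {y} {x ∷ L} (_ ∷ uL) (there y∈L) | no _ =
    let (prodL , lengthL) = prod-remove uL y∈L in
    (begin
      x * prod L                     ≈⟨ *-cong (≈-refl {x}) prodL ⟩
      x * (y * prod (remove y L))    ≡⟨ swap x y _ ⟩
      y * (x * prod (remove y L))    ∎) , cong suc lengthL
    where swap : ∀ a b c → a * (b * c) ≡ b * (a * c)
          swap = solve-∀

  PairedBy : ℤ → List ℤ → Set
  PairedBy c L = ∀ {x} → x ∈ L → Σ ℤ λ y → y ∈ L × x * y ≈ c

  partner-unique : ∀ {c} x {y z} → c ≉ + 0 → x * y ≈ c → x * z ≈ c → y ≈ z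
  partner-unique x {y} c≉0 xy≈c xz≈c = *-cancelˡ-≈ (factor-≉0 x y c≉0 xy≈c) (≈-trans xy≈c (≈-sym xz≈c))

  *-comm-≈ : ∀ {c} x y → x * y ≈ c → y * x ≈ c
  *-comm-≈ x y xy≈c = ≈-trans (≈-reflexive (ℤP.*-comm y x)) xy≈c

  remove-pairedBy : ∀ {c L} y → c ≉ + 0 → PairedBy c L → y * y ≈ c → PairedBy c (remove y L)
  remove-pairedBy y c≉0 paired yy≈c {z} z∈L' with ∈-remove⁻ z∈L'
  ... | z∈L , z≉y with paired z∈L
  ...   | w , w∈L , zw≈c = w , ∈-remove⁺ w∈L w≉y , zw≈c
    where
    w≉y : w ≉ y
    w≉y w≈y = z≉y (partner-unique y c≉0 (*-comm-≈ z y (≈-trans (*-cong (≈-refl {z}) (≈-sym w≈y)) zw≈c)) yy≈c)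

  ∈-tail : ∀ {w x L} → w ∈ x ∷ L → w ≉ x → w ∈ L
  ∈-tail (here w≈x) w≉x = ⊥-elim (w≉x w≈x)
  ∈-tail (there w∈L) _ = w∈L

  remove-pair-pairedBy : ∀ {c x L} y → c ≉ + 0 → x ∉ L → PairedBy c (x ∷ L) → x * y ≈ c → PairedBy c (remove y L)
  remove-pair-pairedBy {x = x} {L} y c≉0 x∉L paired xy≈c {z} z∈L' with ∈-remove⁻ z∈L'
  ... | z∈L , z≉y with paired (there z∈L)
  ...   | w , w∈xL , zw≈c = w , ∈-remove⁺ w∈L w≉y , zw≈c
    where
    w≉y : w ≉ y
    w≉y w≈y = x∉L (MembershipP.∈-resp-≈ ≈-setoid z≈x z∈L)
      where z≈x : z ≈ x
            z≈x = partner-unique y c≉0 (*-comm-≈ z y (≈-trans (*-cong (≈-refl {z}) (≈-sym w≈y)) zw≈c))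
                                       (*-comm-≈ x y xy≈c)
    w∈L : w ∈ L
    w∈L = ∈-tail w∈xL λ w≈x → z≉y (partner-unique x c≉0
            (*-comm-≈ z x (≈-trans (*-cong (≈-refl {z}) (≈-sym w≈x)) zw≈c)) xy≈c)

  -- The fuel n bounds the length: the recursive call drops two elements, so it is not structural.
  pairing : ∀ {c} → c ≉ + 0 → ∀ n L → length L ℕ.≤ n → Unique L → PairedBy c L →
            (∀ {x} → x ∈ L → x * x ≉ c) → Σ ℕ λ k → 2 ℕ.* k ≡ length L × prod L ≈ c ^ k
  pairing c≉0 _ [] _ _ _ _ = 0 , refl , ≈-refl
  pairing c≉0 zero (x ∷ L) () _ _ _
  pairing {c} c≉0 (suc n) (x ∷ L) (s≤s |L|≤n) xL-unique@(_ ∷ L-unique) paired fixed-point-free =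
    suc k , 2[1+k]≡1+|L| , (begin
      x * prod L                      ≈⟨ *-cong (≈-refl {x}) (proj₁ removed) ⟩
      x * (y * prod (remove y L))     ≡⟨ sym (ℤP.*-assoc x y _) ⟩
      x * y * prod (remove y L)       ≈⟨ *-cong xy≈c (proj₂ (proj₂ paired-off)) ⟩
      c * c ^ k                       ∎)
    where
    partner = paired (here (≈-refl {x}))
    y = proj₁ partner
    xy≈c : x * y ≈ c
    xy≈c = proj₂ (proj₂ partner)
    y∈L : y ∈ L
    y∈L = ∈-tail (proj₁ (proj₂ partner)) λ y≈x →
            fixed-point-free (here (≈-refl {x})) (≈-trans (*-cong (≈-refl {x}) (≈-sym y≈x)) xy≈c)
    removed = prod-remove L-unique y∈L
    paired-off = pairing c≉0 n (remove y L) (ℕP.<⇒≤ (subst (ℕ._≤ n) (proj₂ removed) |L|≤n))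
                   (remove-unique L-unique)
                   (remove-pair-pairedBy y c≉0 (UniqueP.Unique[x∷xs]⇒x∉xs ≈-setoid xL-unique) paired xy≈c)
                   (λ z∈L' → fixed-point-free (there (proj₁ (∈-remove⁻ z∈L'))))
    k = proj₁ paired-off
    2[1+k]≡1+|L| : 2 ℕ.* suc k ≡ suc (length L)
    2[1+k]≡1+|L| = trans (ℕP.*-suc 2 k) (trans (cong (2 ℕ.+_) (proj₁ (proj₂ paired-off))) (sym (cong suc (proj₂ removed))))

  units : List ℤ
  units = applyUpTo (λ i → + suc i) (p ∸ 1)

  m<n∸1⇒1+m<n : ∀ {m n} → m ℕ.< n ∸ 1 → suc m ℕ.< n
  m<n∸1⇒1+m<n {n = suc n} m<n = s≤s m<n

  1+m<n⇒m<n∸1 : ∀ {m n} → suc m ℕ.< n → m ℕ.< n ∸ 1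
  1+m<n⇒m<n∸1 {n = suc n} (s≤s m<n) = m<n

  units-unique : Unique units
  units-unique = UniqueP.applyUpTo⁺₁ ≈-setoid _ (p ∸ 1) λ i<j j<p∸1 → small-≉ (s≤s i<j) (m<n∸1⇒1+m<n j<p∸1)

  ∈-units⁻ : ∀ {x} → x ∈ units → x ≉ + 0
  ∈-units⁻ x∈units with MembershipP.∈-applyUpTo⁻ ≈-setoid _ x∈units
  ... | i , i<p∸1 , x≈1+i = ≉0-resp x≈1+i (small-≉0 (s≤s z≤n) (m<n∸1⇒1+m<n i<p∸1))

  ∈-units⁺ : ∀ {x} → x ≉ + 0 → x ∈ units
  ∈-units⁺ {x} x≉0 with residue x
  ... | zero , _ , x≈0 = ⊥-elim (x≉0 x≈0)
  ... | suc i , 1+i<p , x≈1+i = MembershipP.∈-resp-≈ ≈-setoid (≈-sym x≈1+i)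
                                  (MembershipP.∈-applyUpTo⁺ ≈-setoid _ (1+m<n⇒m<n∸1 1+i<p))

  units-pairedBy : ∀ {c} → c ≉ + 0 → PairedBy c units
  units-pairedBy {c} c≉0 {x} x∈units =
    y , ∈-units⁺ (λ y≈0 → c≉0 (≈-trans (≈-sym xy≈c) (≈-trans (*-cong (≈-refl {x}) y≈0) (≈-reflexive (ℤP.*-zeroʳ x))))) , xy≈c
    where
    x⁻¹ = inverse (∈-units⁻ x∈units)
    y = proj₁ x⁻¹ * c
    xy≈c : x * y ≈ c
    xy≈c = begin
      x * (proj₁ x⁻¹ * c)  ≡⟨ sym (ℤP.*-assoc x _ c) ⟩
      x * proj₁ x⁻¹ * c    ≈⟨ *-cong (proj₂ x⁻¹) (≈-refl {c}) ⟩
      + 1 * c              ≡⟨ ℤP.*-identityˡ c ⟩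
      c                    ∎

  prod-units-nonsquare : ∀ {c} → IsNonSquare c → prod units ≈ c ^ half
  prod-units-nonsquare {c} (c≉0 , c-nonsquare) =
    subst (λ k → prod units ≈ c ^ k) (2*k≡p∸1⇒k≡half {k} 2k≡p∸1) (proj₂ (proj₂ paired-off))
    where
    paired-off = pairing c≉0 (length units) units ℕP.≤-refl units-unique (units-pairedBy c≉0)
                   (λ {x} _ xx≈c → c-nonsquare (x , ≈-sym xx≈c))
    k = proj₁ paired-off
    2k≡p∸1 : 2 ℕ.* k ≡ p ∸ 1
    2k≡p∸1 = trans (proj₁ (proj₂ paired-off)) (ListP.length-applyUpTo _ (p ∸ 1))

  units∖± : ℤ → List ℤ
  units∖± s = remove (- s) (remove s units)

  module _ {s} (s≉0 : s ≉ + 0) where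

    private
      removed-s = prod-remove units-unique (∈-units⁺ s≉0)
      removed-[-s] = prod-remove (remove-unique units-unique)
                       (∈-remove⁺ (∈-units⁺ (-‿≉0 s≉0)) λ -s≈s → x≉-x s≉0 (≈-sym -s≈s))

    prod-units∖± : prod units ≈ - (s * s) * prod (units∖± s)
    prod-units∖± = begin
      prod units                      ≈⟨ proj₁ removed-s ⟩
      s * prod (remove s units)       ≈⟨ *-cong (≈-refl {s}) (proj₁ removed-[-s]) ⟩
      s * (- s * prod (units∖± s))    ≡⟨ regroup s (prod (units∖± s)) ⟩
      - (s * s) * prod (units∖± s)    ∎
      where regroup : ∀ s t → s * (- s * t) ≡ - (s * s) * t
            regroup = solve-∀

    length-units∖± : p ∸ 1 ≡ 2 ℕ.+ length (units∖± s)
    length-units∖± = trans (sym (ListP.length-applyUpTo _ (p ∸ 1)))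
                       (trans (proj₂ removed-s) (cong suc (proj₂ removed-[-s])))

    units∖±-pairedBy : PairedBy (s * s) (units∖± s)
    units∖±-pairedBy = remove-pairedBy (- s) s*s≉0 (remove-pairedBy s s*s≉0 (units-pairedBy s*s≉0) (≈-refl {s * s}))
                         (≈-reflexive (neg-square s))
      where
      s*s≉0 : s * s ≉ + 0
      s*s≉0 = *-≉0 s≉0 s≉0
      neg-square : ∀ s → - s * - s ≡ s * s
      neg-square = solve-∀

    units∖±-fixed-point-free : ∀ {x} → x ∈ units∖± s → x * x ≉ s * s
    units∖±-fixed-point-free {x} x∈L xx≈ss with ∈-remove⁻ {y = - s} {remove s units} x∈L
    ... | x∈L₁ , x≉-s with x*x≈y*y⇒x≈y⊎x≈-y x s xx≈ss
    ...   | inj₁ x≈s = proj₂ (∈-remove⁻ {y = s} {units} x∈L₁) x≈s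
    ...   | inj₂ x≈-s = x≉-s x≈-s

  prod-units-square : ∀ {s} → s ≉ + 0 → prod units ≈ - ((s * s) ^ half)
  prod-units-square {s} s≉0 = begin
    prod units                 ≈⟨ prod-units∖± s≉0 ⟩
    - c * prod (units∖± s)     ≈⟨ *-cong (≈-refl { - c}) (proj₂ (proj₂ paired-off)) ⟩
    - c * c ^ k                ≡⟨ sym (ℤP.neg-distribˡ-* c (c ^ k)) ⟩
    - (c ^ suc k)              ≡⟨ cong (λ n → - (c ^ n)) (2*k≡p∸1⇒k≡half {suc k} 2[1+k]≡p∸1) ⟩
    - (c ^ half)               ∎
    where
    c = s * s
    paired-off = pairing (*-≉0 s≉0 s≉0) _ (units∖± s) ℕP.≤-refl (remove-unique (remove-unique units-unique))
                   (units∖±-pairedBy s≉0) (units∖±-fixed-point-free s≉0)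
    k = proj₁ paired-off
    2[1+k]≡p∸1 : 2 ℕ.* suc k ≡ p ∸ 1
    2[1+k]≡p∸1 = trans (ℕP.*-suc 2 k) (trans (cong (2 ℕ.+_) (proj₁ (proj₂ paired-off))) (sym (length-units∖± s≉0)))

  wilson : prod units ≈ - + 1
  wilson = ≈-trans (prod-units-square 1≉0) (≈-reflexive (cong -_ (ℤP.^-zeroˡ half)))

  euler-square : ∀ {c} → IsSquare c → c ≉ + 0 → c ^ half ≈ + 1
  euler-square {c} (s , c≈ss) c≉0 = -‿injective (begin
    - (c ^ half)         ≈⟨ -‿cong (^-cong half c≈ss) ⟩
    - ((s * s) ^ half)   ≈⟨ ≈-sym (prod-units-square (square-≉0 s c≈ss c≉0)) ⟩
    prod units           ≈⟨ wilson ⟩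
    - + 1                ∎)

  euler-nonsquare : ∀ {c} → IsNonSquare c → c ^ half ≈ - + 1
  euler-nonsquare c-nonsquare = ≈-trans (≈-sym (prod-units-nonsquare c-nonsquare)) wilson

  euler⇒square : ∀ {c} → c ≉ + 0 → c ^ half ≈ + 1 → IsSquare c
  euler⇒square {c} c≉0 cʰ≈1 with IsSquare? c
  ... | yes c-square = c-square
  ... | no c-nonsquare = ⊥-elim (1≉-1 (≈-trans (≈-sym cʰ≈1) (euler-nonsquare (c≉0 , c-nonsquare))))

  square*square : ∀ {x y} → IsSquare x → IsSquare y → IsSquare (x * y)
  square*square (s , x≈ss) (t , y≈tt) = s * t , ≈-trans (*-cong x≈ss y≈tt) (≈-reflexive (interchange s t))
    where interchange : ∀ s t → s * s * (t * t) ≡ s * t * (s * t)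
          interchange = solve-∀

  square*nonsquare : ∀ {x y} → IsSquare x → x ≉ + 0 → IsNonSquare y → IsNonSquare (x * y)
  square*nonsquare {x} {y} x-square x≉0 y-nonsquare@(y≉0 , _) = xy≉0 , λ xy-square → 1≉-1 (begin
    + 1                  ≈⟨ ≈-sym (euler-square xy-square xy≉0) ⟩
    (x * y) ^ half       ≡⟨ ^-distribʳ-* x y half ⟩
    x ^ half * y ^ half  ≈⟨ *-cong (euler-square x-square x≉0) (euler-nonsquare y-nonsquare) ⟩
    - + 1                ∎)
    where xy≉0 : x * y ≉ + 0
          xy≉0 = *-≉0 x≉0 y≉0

  nonsquare*nonsquare : ∀ {x y} → IsNonSquare x → IsNonSquare y → IsSquare (x * y)
  nonsquare*nonsquare {x} {y} x-nonsquare y-nonsquare = euler⇒square (*-≉0 (proj₁ x-nonsquare) (proj₁ y-nonsquare)) (begin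
    (x * y) ^ half       ≡⟨ ^-distribʳ-* x y half ⟩
    x ^ half * y ^ half  ≈⟨ *-cong (euler-nonsquare x-nonsquare) (euler-nonsquare y-nonsquare) ⟩
    + 1                  ∎)

  -1^[2*q]≡1 : ∀ q → (- + 1) ^ (2 ℕ.* q) ≡ + 1
  -1^[2*q]≡1 q = trans (sym (ℤP.^-*-assoc (- + 1) 2 q)) (ℤP.^-zeroˡ q)

  p∸1≡r+4q : ∀ {r} → p % 4 ≡ suc r → p ∸ 1 ≡ r ℕ.+ (p / 4) ℕ.* 4
  p∸1≡r+4q p%4≡1+r = cong (_∸ 1) (trans (m≡m%n+[m/n]*n p 4) (cong (ℕ._+ (p / 4) ℕ.* 4) p%4≡1+r))

  half≡2q : p % 4 ≡ 1 → half ≡ 2 ℕ.* (p / 4)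
  half≡2q p%4≡1 = sym (2*k≡p∸1⇒k≡half (trans (identity (p / 4)) (sym (p∸1≡r+4q p%4≡1))))
    where identity : ∀ q → 2 ℕ.* (2 ℕ.* q) ≡ q ℕ.* 4
          identity = ℕRing.solve-∀

  half≡1+2q : p % 4 ≡ 3 → half ≡ suc (2 ℕ.* (p / 4))
  half≡1+2q p%4≡3 = sym (2*k≡p∸1⇒k≡half (trans (identity (p / 4)) (sym (p∸1≡r+4q p%4≡3))))
    where identity : ∀ q → 2 ℕ.* suc (2 ℕ.* q) ≡ 2 ℕ.+ q ℕ.* 4
          identity = ℕRing.solve-∀

  -1-square : p % 4 ≡ 1 → IsSquare (- + 1)
  -1-square p%4≡1 = euler⇒square (-‿≉0 1≉0)
    (≈-reflexive (trans (cong ((- + 1) ^_) (half≡2q p%4≡1)) (-1^[2*q]≡1 (p / 4))))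

  -1-nonsquare : p % 4 ≡ 3 → IsNonSquare (- + 1)
  -1-nonsquare p%4≡3 = -‿≉0 1≉0 , λ -1-square → 1≉-1 (begin
    + 1                              ≈⟨ ≈-sym (euler-square -1-square (-‿≉0 1≉0)) ⟩
    (- + 1) ^ half                   ≡⟨ cong ((- + 1) ^_) (half≡1+2q p%4≡3) ⟩
    - + 1 * (- + 1) ^ (2 ℕ.* (p / 4)) ≡⟨ cong (- + 1 *_) (-1^[2*q]≡1 (p / 4)) ⟩
    - + 1                            ∎)

module Matrices (p : ℕ) (p-prime : Prime p) where
  open Residues p p-prime

  infix 4 _≋_
  record _≋_ (m n : Mat) : Set where
    constructor mk≋
    field
      ≈₁₁ : m₁₁ m ≈ m₁₁ n
      ≈₁₂ : m₁₂ m ≈ m₁₂ n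
      ≈₂₁ : m₂₁ m ≈ m₂₁ n
      ≈₂₂ : m₂₂ m ≈ m₂₂ n
  open _≋_ public

  ≋-refl : ∀ {m} → m ≋ m
  ≋-refl = mk≋ ≈-refl ≈-refl ≈-refl ≈-refl

  ≋-sym : ∀ {m n} → m ≋ n → n ≋ m
  ≋-sym (mk≋ e₁₁ e₁₂ e₂₁ e₂₂) = mk≋ (≈-sym e₁₁) (≈-sym e₁₂) (≈-sym e₂₁) (≈-sym e₂₂)

  ≋-trans : ∀ {m n o} → m ≋ n → n ≋ o → m ≋ o
  ≋-trans (mk≋ e₁₁ e₁₂ e₂₁ e₂₂) (mk≋ f₁₁ f₁₂ f₂₁ f₂₂) =
    mk≋ (≈-trans e₁₁ f₁₁) (≈-trans e₁₂ f₁₂) (≈-trans e₂₁ f₂₁) (≈-trans e₂₂ f₂₂)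

  ≋-reflexive : ∀ {m n} → m ≡ n → m ≋ n
  ≋-reflexive refl = ≋-refl

  ≋-setoid : Setoid _ _
  ≋-setoid = record
    { Carrier = Mat ; _≈_ = _≋_
    ; isEquivalence = record { refl = ≋-refl ; sym = ≋-sym ; trans = ≋-trans } }

  module ≋-Reasoning = SetoidReasoning ≋-setoid

  ≋[mod]⇒≋ : ∀ {m n} → m ≋ n [mod p ] → m ≋ n
  ≋[mod]⇒≋ (e₁₁ , e₁₂ , e₂₁ , e₂₂) = mk≋ (≡[mod]⇒≈ e₁₁) (≡[mod]⇒≈ e₁₂) (≡[mod]⇒≈ e₂₁) (≡[mod]⇒≈ e₂₂)

  ≋⇒≋[mod] : ∀ {m n} → m ≋ n → m ≋ n [mod p ]
  ≋⇒≋[mod] (mk≋ e₁₁ e₁₂ e₂₁ e₂₂) = ≈⇒≡[mod] e₁₁ , ≈⇒≡[mod] e₁₂ , ≈⇒≡[mod] e₂₁ , ≈⇒≡[mod] e₂₂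

  mat-≡ : ∀ {a b c d a' b' c' d'} → a ≡ a' → b ≡ b' → c ≡ c' → d ≡ d' → mat a b c d ≡ mat a' b' c' d'
  mat-≡ refl refl refl refl = refl

  ·-cong : ∀ {m m' n n'} → m ≋ m' → n ≋ n' → m · n ≋ m' · n'
  ·-cong {mat _ _ _ _} {mat _ _ _ _} {mat _ _ _ _} {mat _ _ _ _} (mk≋ a b c d) (mk≋ a' b' c' d') =
    mk≋ (+-cong (*-cong a a') (*-cong b c')) (+-cong (*-cong a b') (*-cong b d'))
        (+-cong (*-cong c a') (*-cong d c')) (+-cong (*-cong c b') (*-cong d d'))

  ·-congˡ : ∀ m {n n'} → n ≋ n' → m · n ≋ m · n'
  ·-congˡ m = ·-cong (≋-refl {m})

  ·-congʳ : ∀ n {m m'} → m ≋ m' → m · n ≋ m' · n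
  ·-congʳ n m≋m' = ·-cong m≋m' (≋-refl {n})

  scal-cong : ∀ {c c' m m'} → c ≈ c' → m ≋ m' → scal c m ≋ scal c' m'
  scal-cong {m = mat _ _ _ _} {mat _ _ _ _} c≈c' (mk≋ a b c d) =
    mk≋ (*-cong c≈c' a) (*-cong c≈c' b) (*-cong c≈c' c) (*-cong c≈c' d)

  scal-congʳ : ∀ c {m m'} → m ≋ m' → scal c m ≋ scal c m'
  scal-congʳ c = scal-cong (≈-refl {c})

  ·-assoc : ∀ m n o → (m · n) · o ≡ m · (n · o)
  ·-assoc (mat a b c d) (mat e f g h) (mat i j k l) =
    mat-≡ (assoc a b e f g h i k) (assoc a b e f g h j l) (assoc c d e f g h i k) (assoc c d e f g h j l)
    where assoc : ∀ a b e f g h i k → (a * e + b * g) * i + (a * f + b * h) * k ≡ a * (e * i + f * k) + b * (g * i + h * k)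
          assoc = solve-∀

  scal-·ˡ : ∀ c m n → scal c m · n ≡ scal c (m · n)
  scal-·ˡ c (mat a b e d) (mat i j k l) = mat-≡ (pull c a b i k) (pull c a b j l) (pull c e d i k) (pull c e d j l)
    where pull : ∀ c a b i k → (c * a) * i + (c * b) * k ≡ c * (a * i + b * k)
          pull = solve-∀

  scal-·ʳ : ∀ c m n → m · scal c n ≡ scal c (m · n)
  scal-·ʳ c (mat a b e d) (mat i j k l) = mat-≡ (pull c a b i k) (pull c a b j l) (pull c e d i k) (pull c e d j l)
    where pull : ∀ c a b i k → a * (c * i) + b * (c * k) ≡ c * (a * i + b * k)
          pull = solve-∀

  scal-scal : ∀ c d m → scal c (scal d m) ≡ scal (c * d) m
  scal-scal c d (mat a b e f) = mat-≡ (assoc c d a) (assoc c d b) (assoc c d e) (assoc c d f)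
    where assoc : ∀ c d a → c * (d * a) ≡ (c * d) * a
          assoc = solve-∀

  scal-identity : ∀ m → scal (+ 1) m ≡ m
  scal-identity (mat a b c d) = mat-≡ (ℤP.*-identityˡ a) (ℤP.*-identityˡ b) (ℤP.*-identityˡ c) (ℤP.*-identityˡ d)

  ·-scal-I : ∀ c m → m · scal c I₂ ≡ scal c m
  ·-scal-I c (mat a b e d) = mat-≡ (left c a b) (right c a b) (left c e d) (right c e d)
    where left : ∀ c a b → a * (c * + 1) + b * (c * + 0) ≡ c * a
          left = solve-∀
          right : ∀ c a b → a * (c * + 0) + b * (c * + 1) ≡ c * b
          right = solve-∀

  scal-I-· : ∀ c m → scal c I₂ · m ≡ scal c m
  scal-I-· c (mat a b e d) = mat-≡ (top c a e) (top c b d) (bottom c a e) (bottom c b d)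
    where top : ∀ c a e → (c * + 1) * a + (c * + 0) * e ≡ c * a
          top = solve-∀
          bottom : ∀ c a e → (c * + 0) * a + (c * + 1) * e ≡ c * e
          bottom = solve-∀

  ·-adj : ∀ m → m · adj m ≡ scal (det m) I₂
  ·-adj (mat a b c d) = mat-≡ (e₁₁ a b c d) (e₁₂ a b c d) (e₂₁ a b c d) (e₂₂ a b c d)
    where e₁₁ : ∀ a b c d → a * d + b * (- c) ≡ (a * d - b * c) * + 1
          e₁₁ = solve-∀
          e₁₂ : ∀ a b c d → a * (- b) + b * a ≡ (a * d - b * c) * + 0
          e₁₂ = solve-∀
          e₂₁ : ∀ a b c d → c * d + d * (- c) ≡ (a * d - b * c) * + 0
          e₂₁ = solve-∀
          e₂₂ : ∀ a b c d → c * (- b) + d * a ≡ (a * d - b * c) * + 1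
          e₂₂ = solve-∀

  adj-· : ∀ m → adj m · m ≡ scal (det m) I₂
  adj-· (mat a b c d) = mat-≡ (e₁₁ a b c d) (e₁₂ a b c d) (e₂₁ a b c d) (e₂₂ a b c d)
    where e₁₁ : ∀ a b c d → d * a + (- b) * c ≡ (a * d - b * c) * + 1
          e₁₁ = solve-∀
          e₁₂ : ∀ a b c d → d * b + (- b) * d ≡ (a * d - b * c) * + 0
          e₁₂ = solve-∀
          e₂₁ : ∀ a b c d → (- c) * a + a * c ≡ (a * d - b * c) * + 0
          e₂₁ = solve-∀
          e₂₂ : ∀ a b c d → (- c) * b + a * d ≡ (a * d - b * c) * + 1
          e₂₂ = solve-∀

  adj-adj : ∀ m → adj (adj m) ≡ m
  adj-adj (mat a b c d) = mat-≡ refl (ℤP.neg-involutive b) (ℤP.neg-involutive c) refl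

  det-· : ∀ m n → det (m · n) ≡ det m * det n
  det-· (mat a b c d) (mat e f g h) = multiplicative a b c d e f g h
    where multiplicative : ∀ a b c d e f g h →
            (a * e + b * g) * (c * f + d * h) - (a * f + b * h) * (c * e + d * g) ≡ (a * d - b * c) * (e * h - f * g)
          multiplicative = solve-∀

  det-adj : ∀ m → det (adj m) ≡ det m
  det-adj (mat a b c d) = identity a b c d
    where identity : ∀ a b c d → d * a - (- b) * (- c) ≡ a * d - b * c
          identity = solve-∀

  scal-cancel : ∀ {c m n} → c ≉ + 0 → scal c m ≋ scal c n → m ≋ n
  scal-cancel {m = mat _ _ _ _} {mat _ _ _ _} c≉0 (mk≋ a b c d) =
    mk≋ (*-cancelˡ-≈ c≉0 a) (*-cancelˡ-≈ c≉0 b) (*-cancelˡ-≈ c≉0 c) (*-cancelˡ-≈ c≉0 d)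

module Conjugation (p : ℕ) (p-prime : Prime p) where
  open Residues p p-prime
  open Matrices p p-prime

  Commute : Mat → Mat → Set
  Commute A B = A · B ≋ B · A

  ProjCommute : Mat → Mat → Set
  ProjCommute n m = Σ ℤ λ σ → σ ≉ + 0 × n · m ≋ scal σ (m · n)

  scal-inverse : ∀ {c ι} m → c * ι ≈ + 1 → scal ι (scal c m) ≋ m
  scal-inverse {c} {ι} m cι≈1 = begin
    scal ι (scal c m)  ≡⟨ scal-scal ι c m ⟩
    scal (ι * c) m     ≈⟨ scal-cong (≈-trans (≈-reflexive (ℤP.*-comm ι c)) cι≈1) ≋-refl ⟩
    scal (+ 1) m       ≡⟨ scal-identity m ⟩
    m                  ∎
    where open ≋-Reasoning

  projCommute-refl : ∀ m → ProjCommute m m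
  projCommute-refl m = + 1 , 1≉0 , ≋-reflexive (sym (scal-identity (m · m)))

  projCommute-sym : ∀ n m → ProjCommute n m → ProjCommute m n
  projCommute-sym n m (σ , σ≉0 , nm≋σmn) = ι , ι≉0 , (begin
    m · n                    ≈⟨ ≋-sym (scal-inverse {σ} {ι} (m · n) σι≈1) ⟩
    scal ι (scal σ (m · n))  ≈⟨ scal-congʳ ι (≋-sym nm≋σmn) ⟩
    scal ι (n · m)           ∎)
    where
    open ≋-Reasoning
    ι = proj₁ (inverse σ≉0)
    σι≈1 : σ * ι ≈ + 1
    σι≈1 = proj₂ (inverse σ≉0)
    ι≉0 : ι ≉ + 0
    ι≉0 = factor-≉0 ι σ 1≉0 (≈-trans (≈-reflexive (ℤP.*-comm ι σ)) σι≈1)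

  projCommute-·ʳ : ∀ n m₁ m₂ → ProjCommute n m₁ → ProjCommute n m₂ → ProjCommute n (m₁ · m₂)
  projCommute-·ʳ n m₁ m₂ (σ₁ , σ₁≉0 , nm₁≋) (σ₂ , σ₂≉0 , nm₂≋) = σ₁ * σ₂ , *-≉0 σ₁≉0 σ₂≉0 , (begin
    n · (m₁ · m₂)                    ≡⟨ sym (·-assoc n m₁ m₂) ⟩
    n · m₁ · m₂                      ≈⟨ ·-congʳ m₂ nm₁≋ ⟩
    scal σ₁ (m₁ · n) · m₂            ≡⟨ scal-·ˡ σ₁ (m₁ · n) m₂ ⟩
    scal σ₁ (m₁ · n · m₂)            ≡⟨ cong (scal σ₁) (·-assoc m₁ n m₂) ⟩
    scal σ₁ (m₁ · (n · m₂))          ≈⟨ scal-congʳ σ₁ (·-congˡ m₁ nm₂≋) ⟩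
    scal σ₁ (m₁ · scal σ₂ (m₂ · n))  ≡⟨ cong (scal σ₁) (scal-·ʳ σ₂ m₁ (m₂ · n)) ⟩
    scal σ₁ (scal σ₂ (m₁ · (m₂ · n))) ≡⟨ scal-scal σ₁ σ₂ (m₁ · (m₂ · n)) ⟩
    scal (σ₁ * σ₂) (m₁ · (m₂ · n))   ≡⟨ cong (scal (σ₁ * σ₂)) (sym (·-assoc m₁ m₂ n)) ⟩
    scal (σ₁ * σ₂) (m₁ · m₂ · n)     ∎)
    where open ≋-Reasoning

  conj : Mat → Mat → Mat
  conj n A = n · A · adj n

  commute-respʳ : ∀ A {B B'} → B ≋ B' → Commute A B → Commute A B'
  commute-respʳ A {B} {B'} B≋B' AB≋BA = begin
    A · B'  ≈⟨ ·-congˡ A (≋-sym B≋B') ⟩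
    A · B   ≈⟨ AB≋BA ⟩
    B · A   ≈⟨ ·-congʳ A B≋B' ⟩
    B' · A  ∎
    where open ≋-Reasoning

  commute-scal : ∀ c A B → c ≉ + 0 → Commute A (scal c B) → Commute A B
  commute-scal c A B c≉0 commutes = scal-cancel c≉0 (begin
    scal c (A · B)  ≡⟨ sym (scal-·ʳ c A B) ⟩
    A · scal c B    ≈⟨ commutes ⟩
    scal c B · A    ≡⟨ scal-·ˡ c B A ⟩
    scal c (B · A)  ∎)
    where open ≋-Reasoning

  ·-·adj : ∀ m g → m · g · adj g ≡ scal (det g) m
  ·-·adj m g = trans (·-assoc m g (adj g)) (trans (cong (m ·_) (·-adj g)) (·-scal-I (det g) m))

  ·-cancelʳ : ∀ {m n g} → det g ≉ + 0 → m · g ≋ n · g → m ≋ n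
  ·-cancelʳ {m} {n} {g} g-inv mg≋ng = scal-cancel g-inv (begin
    scal (det g) m   ≡⟨ sym (·-·adj m g) ⟩
    m · g · adj g    ≈⟨ ·-congʳ (adj g) mg≋ng ⟩
    n · g · adj g    ≡⟨ ·-·adj n g ⟩
    scal (det g) n   ∎)
    where open ≋-Reasoning

  conj-· : ∀ n A B → conj n A · conj n B ≡ scal (det n) (conj n (A · B))
  conj-· n A B = begin
    n · A · adj n · (n · B · adj n)      ≡⟨ ·-assoc (n · A) (adj n) (n · B · adj n) ⟩
    n · A · (adj n · (n · B · adj n))    ≡⟨ cong (λ t → n · A · (adj n · t)) (·-assoc n B (adj n)) ⟩
    n · A · (adj n · (n · (B · adj n)))  ≡⟨ cong (n · A ·_) (sym (·-assoc (adj n) n (B · adj n))) ⟩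
    n · A · (adj n · n · (B · adj n))    ≡⟨ cong (λ t → n · A · (t · (B · adj n))) (adj-· n) ⟩
    n · A · (scal δ I₂ · (B · adj n))    ≡⟨ cong (n · A ·_) (scal-I-· δ (B · adj n)) ⟩
    n · A · scal δ (B · adj n)           ≡⟨ scal-·ʳ δ (n · A) (B · adj n) ⟩
    scal δ (n · A · (B · adj n))         ≡⟨ cong (scal δ) (sym (·-assoc (n · A) B (adj n))) ⟩
    scal δ (n · A · B · adj n)           ≡⟨ cong (λ t → scal δ (t · adj n)) (·-assoc n A B) ⟩
    scal δ (n · (A · B) · adj n)         ∎
    where
    open ≡-Reasoning
    δ = det n

  conj-commute : ∀ n A B → Commute A B → Commute (conj n A) (conj n B)
  conj-commute n A B AB≋BA = begin
    conj n A · conj n B          ≡⟨ conj-· n A B ⟩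
    scal (det n) (conj n (A · B)) ≈⟨ scal-congʳ (det n) (·-congʳ (adj n) (·-congˡ n AB≋BA)) ⟩
    scal (det n) (conj n (B · A)) ≡⟨ sym (conj-· n B A) ⟩
    conj n B · conj n A          ∎
    where open ≋-Reasoning

  conj-projCommute : ∀ n m σ → n · m ≋ scal σ (m · n) → conj n m ≋ scal (σ * det n) m
  conj-projCommute n m σ nm≋σmn = begin
    n · m · adj n               ≈⟨ ·-congʳ (adj n) nm≋σmn ⟩
    scal σ (m · n) · adj n      ≡⟨ scal-·ˡ σ (m · n) (adj n) ⟩
    scal σ (m · n · adj n)      ≡⟨ cong (scal σ) (·-·adj m n) ⟩
    scal σ (scal (det n) m)     ≡⟨ scal-scal σ (det n) m ⟩
    scal (σ * det n) m          ∎
    where open ≋-Reasoning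

  det-conj : ∀ n X → det (conj n X) ≡ det n * det X * det n
  det-conj n X = trans (det-· (n · X) (adj n)) (trans (cong (_* det (adj n)) (det-· n X)) (cong (det n * det X *_) (det-adj n)))

  conj-adj : ∀ g X → conj (adj g) X ≡ adj g · X · g
  conj-adj g X = cong (adj g · X ·_) (adj-adj g)

  ·-conj-adj : ∀ g X → g · conj (adj g) X ≡ scal (det g) (X · g)
  ·-conj-adj g X = begin
    g · conj (adj g) X      ≡⟨ cong (g ·_) (conj-adj g X) ⟩
    g · (adj g · X · g)     ≡⟨ sym (·-assoc g (adj g · X) g) ⟩
    g · (adj g · X) · g     ≡⟨ cong (_· g) (sym (·-assoc g (adj g) X)) ⟩
    g · adj g · X · g       ≡⟨ cong (λ t → t · X · g) (·-adj g) ⟩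
    scal (det g) I₂ · X · g ≡⟨ cong (_· g) (scal-I-· (det g) X) ⟩
    scal (det g) X · g      ≡⟨ scal-·ˡ (det g) X g ⟩
    scal (det g) (X · g)    ∎
    where open ≡-Reasoning

  conj-adj-similar : ∀ m g D → m · g ≋ g · D → conj (adj g) m ≋ scal (det g) D
  conj-adj-similar m g D mg≋gD = begin
    conj (adj g) m           ≡⟨ trans (conj-adj g m) (·-assoc (adj g) m g) ⟩
    adj g · (m · g)          ≈⟨ ·-congˡ (adj g) mg≋gD ⟩
    adj g · (g · D)          ≡⟨ sym (·-assoc (adj g) g D) ⟩
    adj g · g · D            ≡⟨ cong (_· D) (adj-· g) ⟩
    scal (det g) I₂ · D      ≡⟨ scal-I-· (det g) D ⟩
    scal (det g) D           ∎
    where open ≋-Reasoning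

  record Torus : Set where
    field
      element : ℤ → ℤ → Mat
      u₀ v₀ : ℤ
    generator : Mat
    generator = element u₀ v₀
    field
      commutes-generator : ∀ u v → Commute (element u v) generator
      centraliser : ∀ K → Commute K generator → Σ ℤ λ u → Σ ℤ λ v → K ≋ element u v
      scal-element : ∀ c u v → scal c (element u v) ≋ element (c * u) (c * v)
  open Torus

  -- g T g⁻¹, in the shape of Defs.SplitCartan and Defs.NonSplitCartan
  Cartan : Torus → Mat → Mat → Set
  Cartan T g X = Inv p X × Σ ℤ λ u → Σ ℤ λ v → (X · g) ≋ (g · element T u v) [mod p ]

  module _ (T : Torus) (g m : Mat) (g-inv : det g ≉ + 0) (mg≋gD : m · g ≋ g · generator T) where

    InConjugate : Mat → Set
    InConjugate X = Σ ℤ λ u → Σ ℤ λ v → X · g ≋ g · element T u v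

    conjugate⇒commute : ∀ X → InConjugate X → Commute X m
    conjugate⇒commute X (u , v , Xg≋gE) = ·-cancelʳ g-inv (begin
      X · m · g      ≡⟨ ·-assoc X m g ⟩
      X · (m · g)    ≈⟨ ·-congˡ X mg≋gD ⟩
      X · (g · D)    ≡⟨ sym (·-assoc X g D) ⟩
      X · g · D      ≈⟨ ·-congʳ D Xg≋gE ⟩
      g · E · D      ≡⟨ ·-assoc g E D ⟩
      g · (E · D)    ≈⟨ ·-congˡ g (commutes-generator T u v) ⟩
      g · (D · E)    ≡⟨ sym (·-assoc g D E) ⟩
      g · D · E      ≈⟨ ·-congʳ E (≋-sym mg≋gD) ⟩
      m · g · E      ≡⟨ ·-assoc m g E ⟩
      m · (g · E)    ≈⟨ ·-congˡ m (≋-sym Xg≋gE) ⟩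
      m · (X · g)    ≡⟨ sym (·-assoc m X g) ⟩
      m · X · g      ∎)
      where
      open ≋-Reasoning
      D = generator T
      E = element T u v

    commute⇒conjugate : ∀ X → Commute X m → InConjugate X
    commute⇒conjugate X Xm≋mX = ι * u , ι * v , (begin
      X · g                          ≈⟨ ≋-sym (scal-inverse {δ} {ι} (X · g) δι≈1) ⟩
      scal ι (scal δ (X · g))        ≡⟨ cong (scal ι) (sym (·-conj-adj g X)) ⟩
      scal ι (g · K)                 ≈⟨ scal-congʳ ι (·-congˡ g K≋E) ⟩
      scal ι (g · element T u v)     ≡⟨ sym (scal-·ʳ ι g (element T u v)) ⟩
      g · scal ι (element T u v)     ≈⟨ ·-congˡ g (scal-element T ι u v) ⟩
      g · element T (ι * u) (ι * v)  ∎)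
      where
      open ≋-Reasoning
      δ = det g
      ι = proj₁ (inverse g-inv)
      δι≈1 : δ * ι ≈ + 1
      δι≈1 = proj₂ (inverse g-inv)
      K = conj (adj g) X
      K-commutes : Commute K (generator T)
      K-commutes = commute-scal δ K (generator T) g-inv
        (commute-respʳ K (conj-adj-similar m g (generator T) mg≋gD) (conj-commute (adj g) X m Xm≋mX))
      centralised = centraliser T K K-commutes
      u = proj₁ centralised
      v = proj₁ (proj₂ centralised)
      K≋E : K ≋ element T u v
      K≋E = proj₂ (proj₂ centralised)

    normalised : ∀ n → det n ≉ + 0 → ProjCommute n m → Normalises p n (Cartan T g)
    normalised n n-inv (σ , σ≉0 , nm≋σmn) X (X-inv , u , v , Xg≋gE) =
      ≉0⇒nonZero conj-inv , u' , v' , ≋⇒≋[mod] conjXg≋gE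
      where
      conj-inv : det (conj n X) ≉ + 0
      conj-inv = ≉0-resp (≈-reflexive (det-conj n X)) (*-≉0 (*-≉0 n-inv (nonZero⇒≉0 X-inv)) n-inv)
      conjX-commutes : Commute (conj n X) m
      conjX-commutes = commute-scal (σ * det n) (conj n X) m (*-≉0 σ≉0 n-inv)
        (commute-respʳ (conj n X) (conj-projCommute n m σ nm≋σmn)
          (conj-commute n X m (conjugate⇒commute X (u , v , ≋[mod]⇒≋ Xg≋gE))))
      conjugated = commute⇒conjugate (conj n X) conjX-commutes
      u' = proj₁ conjugated
      v' = proj₁ (proj₂ conjugated)
      conjXg≋gE = proj₂ (proj₂ conjugated)

module CartanSubgroups (p : ℕ) (p-prime : Prime p) (p≢2 : p ≢ 2) where
  open Residues p p-prime
  open QuadraticResidues p p-prime p≢2 using (2≉0)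
  open Matrices p p-prime
  open Conjugation p p-prime

  -- diag ρ (-ρ) is regular because 2ρ ≠ 0.
  split-torus : (ρ : ℤ) → ρ ≉ + 0 → Torus
  split-torus ρ ρ≉0 = record
    { element = diag ; u₀ = ρ ; v₀ = - ρ
    ; commutes-generator = λ u v → ≋-reflexive (mat-≡ (e₁₁ u v ρ) (e₁₂ u v ρ) (e₂₁ u v ρ) (e₂₂ u v ρ))
    ; centraliser = centraliser
    ; scal-element = λ c u v → ≋-reflexive (mat-≡ refl (ℤP.*-zeroʳ c) (ℤP.*-zeroʳ c) refl) }
    where
    e₁₁ : ∀ u v ρ → u * ρ + + 0 * + 0 ≡ ρ * u + + 0 * + 0
    e₁₁ = solve-∀
    e₁₂ : ∀ u v ρ → u * + 0 + + 0 * - ρ ≡ ρ * + 0 + + 0 * v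
    e₁₂ = solve-∀
    e₂₁ : ∀ u v ρ → + 0 * ρ + v * + 0 ≡ + 0 * u + - ρ * + 0
    e₂₁ = solve-∀
    e₂₂ : ∀ u v ρ → + 0 * + 0 + v * - ρ ≡ + 0 * + 0 + - ρ * v
    e₂₂ = solve-∀
    centraliser : ∀ K → Commute K (diag ρ (- ρ)) → Σ ℤ λ u → Σ ℤ λ v → K ≋ diag u v
    centraliser (mat k₁ k₂ k₃ k₄) (mk≋ _ e₁₂ e₂₁ _) = k₁ , k₄ , mk≋ ≈-refl
      (x*y≈0⇒y≈0 2ρ≉0 (≈-via (upper ρ k₁ k₂ k₄) (- + 1 ⊛ difference e₁₂)))
      (x*y≈0⇒y≈0 2ρ≉0 (≈-via (lower ρ k₁ k₃ k₄) (difference e₂₁))) ≈-refl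
      where
      2ρ≉0 = *-≉0 2≉0 ρ≉0
      upper : ∀ ρ k₁ k₂ k₄ → + 2 * ρ * k₂ - + 0 ≡ - + 1 * (k₁ * + 0 + k₂ * - ρ - (ρ * k₂ + + 0 * k₄))
      upper = solve-∀
      lower : ∀ ρ k₁ k₃ k₄ → + 2 * ρ * k₃ - + 0 ≡ k₃ * ρ + k₄ * + 0 - (+ 0 * k₁ + - ρ * k₃)
      lower = solve-∀

  -- nsMat α (+ 0) (+ 1) is multiplication by √α on F_p(√α), whose centraliser is F_p(√α).
  nonsplit-torus : ℤ → Torus
  nonsplit-torus α = record
    { element = nsMat α ; u₀ = + 0 ; v₀ = + 1
    ; commutes-generator = λ u v → ≋-reflexive (mat-≡ (e₁₁ α u v) (e₁₂ α u v) (e₂₁ α u v) (e₂₂ α u v))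
    ; centraliser = centraliser
    ; scal-element = λ c u v → ≋-reflexive (mat-≡ refl (swap c α v) refl refl) }
    where
    e₁₁ : ∀ α u v → u * + 0 + α * v * + 1 ≡ + 0 * u + α * + 1 * v
    e₁₁ = solve-∀
    e₁₂ : ∀ α u v → u * (α * + 1) + α * v * + 0 ≡ + 0 * (α * v) + α * + 1 * u
    e₁₂ = solve-∀
    e₂₁ : ∀ α u v → v * + 0 + u * + 1 ≡ + 1 * u + + 0 * v
    e₂₁ = solve-∀
    e₂₂ : ∀ α u v → v * (α * + 1) + u * + 0 ≡ + 1 * (α * v) + + 0 * u
    e₂₂ = solve-∀
    swap : ∀ c α v → c * (α * v) ≡ α * (c * v)
    swap = solve-∀
    centraliser : ∀ K → Commute K (nsMat α (+ 0) (+ 1)) → Σ ℤ λ u → Σ ℤ λ v → K ≋ nsMat α u v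
    centraliser (mat k₁ k₂ k₃ k₄) (mk≋ e₁₁ _ e₂₁ _) = k₁ , k₃ , mk≋ ≈-refl
      (≈-via (upper α k₁ k₂ k₃) (difference e₁₁)) ≈-refl (≈-via (lower k₁ k₃ k₄) (difference e₂₁))
      where
      upper : ∀ α k₁ k₂ k₃ → k₂ - α * k₃ ≡ k₁ * + 0 + k₂ * + 1 - (+ 0 * k₁ + α * + 1 * k₃)
      upper = solve-∀
      lower : ∀ k₁ k₃ k₄ → k₄ - k₁ ≡ k₃ * + 0 + k₄ * + 1 - (+ 1 * k₁ + + 0 * k₃)
      lower = solve-∀

  TraceZero : Mat → Set
  TraceZero m = m₁₁ m + m₂₂ m ≈ + 0

  trace-zero-form : ∀ m → TraceZero m → m ≋ mat (m₁₁ m) (m₁₂ m) (m₂₁ m) (- m₁₁ m)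
  trace-zero-form (mat a b c d) a+d≈0 = mk≋ ≈-refl ≈-refl ≈-refl (≈-via (identity a d) (difference a+d≈0))
    where identity : ∀ a d → d - - a ≡ a + d - + 0
          identity = solve-∀

  -det-trace-zero : ∀ m → TraceZero m → - det m ≈ m₁₁ m * m₁₁ m + m₁₂ m * m₂₁ m
  -det-trace-zero (mat a b c d) a+d≈0 = ≈-via (identity a b c d) (- a ⊛ difference a+d≈0)
    where identity : ∀ a b c d → - (a * d - b * c) - (a * a + b * c) ≡ - a * (a + d - + 0)
          identity = solve-∀

  Diagonalisable : Mat → Set
  Diagonalisable m = Σ Mat λ g → Σ ℤ λ ρ → det g ≉ + 0 × ρ ≉ + 0 × m · g ≋ g · diag ρ (- ρ)

  -- The columns of g are the eigenvectors (t , ±q - s).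
  diagonalise-t≉0 : ∀ s t r {q} → s * s + t * r ≈ q * q → q ≉ + 0 → t ≉ + 0 → Diagonalisable (mat s t r (- s))
  diagonalise-t≉0 s t r {q} α≈qq q≉0 t≉0 = mat t t (q - s) (- q - s) , q , det≉0 , q≉0 ,
    mk≋ (≈-reflexive (e₁₁ s t q)) (≈-reflexive (e₁₂ s t q))
        (≈-via (e₂₁ s t r q) (difference α≈qq)) (≈-via (e₂₂ s t r q) (difference α≈qq))
    where
    det-identity : ∀ s t q → + 2 * (t * q) - + 0 ≡ - + 1 * (t * (- q - s) - t * (q - s) - + 0)
    det-identity = solve-∀
    det≉0 : t * (- q - s) - t * (q - s) ≉ + 0
    det≉0 det≈0 = *-≉0 2≉0 (*-≉0 t≉0 q≉0) (≈-via (det-identity s t q) (- + 1 ⊛ difference det≈0))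
    e₁₁ : ∀ s t q → s * t + t * (q - s) ≡ t * q + t * + 0
    e₁₁ = solve-∀
    e₁₂ : ∀ s t q → s * t + t * (- q - s) ≡ t * + 0 + t * - q
    e₁₂ = solve-∀
    e₂₁ : ∀ s t r q → r * t + - s * (q - s) - ((q - s) * q + (- q - s) * + 0) ≡ s * s + t * r - q * q
    e₂₁ = solve-∀
    e₂₂ : ∀ s t r q → r * t + - s * (- q - s) - ((q - s) * + 0 + (- q - s) * - q) ≡ s * s + t * r - q * q
    e₂₂ = solve-∀

  -- The columns of g are the eigenvectors (2s , r) and (0 , 1).
  diagonalise-t≈0 : ∀ s t r {q} → s * s + t * r ≈ q * q → q ≉ + 0 → t ≈ + 0 → Diagonalisable (mat s t r (- s))
  diagonalise-t≈0 s t r {q} α≈qq q≉0 t≈0 = mat (+ 2 * s) (+ 0) r (+ 1) , s , det≉0 , s≉0 ,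
    mk≋ (≈-via (e₁₁ s t r) (r ⊛ difference t≈0)) (≈-via (e₁₂ s t) (difference t≈0))
        (≈-reflexive (e₂₁ s r)) (≈-reflexive (e₂₂ s r))
    where
    α-identity : ∀ s t r → s * s + t * r - + 0 ≡ s * (s - + 0) + r * (t - + 0)
    α-identity = solve-∀
    s≉0 : s ≉ + 0
    s≉0 s≈0 = *-≉0 q≉0 q≉0 (≈-trans (≈-sym α≈qq) (≈-via (α-identity s t r) (s ⊛ difference s≈0 ⊕ r ⊛ difference t≈0)))
    det-identity : ∀ s r → + 2 * s - + 0 ≡ + 2 * s * + 1 - + 0 * r - + 0
    det-identity = solve-∀
    det≉0 : + 2 * s * + 1 - + 0 * r ≉ + 0
    det≉0 det≈0 = *-≉0 2≉0 s≉0 (≈-via (det-identity s r) (difference det≈0))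
    e₁₁ : ∀ s t r → s * (+ 2 * s) + t * r - (+ 2 * s * s + + 0 * + 0) ≡ r * (t - + 0)
    e₁₁ = solve-∀
    e₁₂ : ∀ s t → s * + 0 + t * + 1 - (+ 2 * s * + 0 + + 0 * - s) ≡ t - + 0
    e₁₂ = solve-∀
    e₂₁ : ∀ s r → r * (+ 2 * s) + - s * r ≡ r * s + + 1 * + 0
    e₂₁ = solve-∀
    e₂₂ : ∀ s r → r * + 0 + - s * + 1 ≡ r * + 0 + + 1 * - s
    e₂₂ = solve-∀

  diagonalise : ∀ s t r {q} → s * s + t * r ≈ q * q → q ≉ + 0 → Diagonalisable (mat s t r (- s))
  diagonalise s t r α≈qq q≉0 with t ≈? + 0
  ... | yes t≈0 = diagonalise-t≈0 s t r α≈qq q≉0 t≈0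
  ... | no t≉0 = diagonalise-t≉0 s t r α≈qq q≉0 t≉0

  -- In the basis (1 , 0), (s , r) the matrix (s t ; r -s) acts as √α with α = s² + tr.
  nonsplit-form : ∀ s t r → ¬ IsSquare (s * s + t * r) →
                  Σ Mat λ g → det g ≉ + 0 × mat s t r (- s) · g ≋ g · nsMat (s * s + t * r) (+ 0) (+ 1)
  nonsplit-form s t r α-nonsquare = mat (+ 1) s (+ 0) r , det≉0 ,
    ≋-reflexive (mat-≡ (e₁₁ s t) (e₁₂ s t r) (e₂₁ s r) (e₂₂ s t r))
    where
    det≉0 : + 1 * r - s * + 0 ≉ + 0
    det≉0 det≈0 = α-nonsquare (s , ≈-via (α-identity s t r) (t ⊛ difference det≈0))
      where α-identity : ∀ s t r → s * s + t * r - s * s ≡ t * (+ 1 * r - s * + 0 - + 0)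
            α-identity = solve-∀
    e₁₁ : ∀ s t → s * + 1 + t * + 0 ≡ + 1 * + 0 + s * + 1
    e₁₁ = solve-∀
    e₁₂ : ∀ s t r → s * s + t * r ≡ + 1 * ((s * s + t * r) * + 1) + s * + 0
    e₁₂ = solve-∀
    e₂₁ : ∀ s r → r * + 1 + - s * + 0 ≡ + 0 * + 0 + r * + 1
    e₂₁ = solve-∀
    e₂₂ : ∀ s t r → r * s + - s * r ≡ + 0 * ((s * s + t * r) * + 1) + r * + 0
    e₂₂ = solve-∀

  module _ (a b m : Mat) (a-inv : det a ≉ + 0) (b-inv : det b ≉ + 0)
           (a~m : ProjCommute a m) (b~m : ProjCommute b m)
           (m-inv : det m ≉ + 0) (m-trace : TraceZero m) where

    private
      s = m₁₁ m
      t = m₁₂ m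
      r = m₂₁ m

    m≋ : m ≋ mat s t r (- s)
    m≋ = trace-zero-form m m-trace

    split-normaliser : IsSquare (- det m) → InSplitNorm p a b m
    split-normaliser (q , -det≈qq) =
      let (g , ρ , g-inv , ρ≉0 , m'g≋gD) = diagonalise s t r α≈qq (square-≉0 q -det≈qq (-‿≉0 m-inv))
          T = split-torus ρ ρ≉0
          mg≋gD = ≋-trans (·-congʳ g m≋) m'g≋gD
      in g , ≉0⇒nonZero g-inv , (≉0⇒nonZero m-inv , ρ , - ρ , ≋⇒≋[mod] mg≋gD) ,
         normalised T g m g-inv mg≋gD a a-inv a~m , normalised T g m g-inv mg≋gD b b-inv b~m
      where α≈qq : s * s + t * r ≈ q * q
            α≈qq = ≈-trans (≈-sym (-det-trace-zero m m-trace)) -det≈qq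

    nonsplit-normaliser : IsNonSquare (- det m) → InNonSplitNorm p a b m
    nonsplit-normaliser -det-nonsquare =
      let (g , g-inv , m'g≋gD) = nonsplit-form s t r (proj₂ α-nonsquare)
          T = nonsplit-torus (s * s + t * r)
          mg≋gD = ≋-trans (·-congʳ g m≋) m'g≋gD
      in s * s + t * r , IsNonSquare⇒NonSquare α-nonsquare , g , ≉0⇒nonZero g-inv ,
         (≉0⇒nonZero m-inv , + 0 , + 1 , ≋⇒≋[mod] mg≋gD) ,
         normalised T g m g-inv mg≋gD a a-inv a~m , normalised T g m g-inv mg≋gD b b-inv b~m
      where α-nonsquare : IsNonSquare (s * s + t * r)
            α-nonsquare = IsNonSquare-resp (≈-sym (-det-trace-zero m m-trace)) -det-nonsquare

module KleinFourSubgroups (p : ℕ) (p-prime : Prime p) (p≢2 : p ≢ 2) where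
  open Residues p p-prime
  open QuadraticResidues p p-prime p≢2
  open Matrices p p-prime
  open Conjugation p p-prime
  open CartanSubgroups p p-prime p≢2

  -- If tr m ≠ 0 then m² = λ forces m to be scalar (Cayley–Hamilton).
  involution-trace-zero : ∀ m λ' → λ' ≉ + 0 → m · m ≋ scal λ' I₂ → ¬ ProjEq p m I₂ → TraceZero m
  involution-trace-zero (mat a b c d) λ' λ'≉0 (mk≋ e₁₁ e₁₂ e₂₁ e₂₂) non-scalar =
    decidable-stable (a + d ≈? + 0) λ a+d≉0 → non-scalar (scalar a+d≉0)
    where
    upper : ∀ λ' a b d → (a + d) * b - + 0 ≡ a * b + b * d - λ' * + 0
    upper = solve-∀
    lower : ∀ λ' a c d → (a + d) * c - + 0 ≡ c * a + d * c - λ' * + 0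
    lower = solve-∀
    diagonal : ∀ λ' a b c d → a * a - d * d ≡ a * a + b * c - λ' * + 1 + - + 1 * (c * b + d * d - λ' * + 1)
    diagonal = solve-∀
    trace : ∀ a d → a + d - + 0 ≡ a - - d
    trace = solve-∀
    λ'-identity : ∀ λ' a b c → λ' - + 0 ≡ - + 1 * (a * a + b * c - λ' * + 1) + a * (a - + 0) + c * (b - + 0)
    λ'-identity = solve-∀
    scalar : a + d ≉ + 0 → ProjEq p (mat a b c d) I₂
    scalar a+d≉0 = a , ≉0⇒nonZero a≉0 , ≋⇒≋[mod]
      (mk≋ (≈-reflexive (sym (ℤP.*-identityʳ a))) (≈-trans b≈0 (≈-reflexive (sym (ℤP.*-zeroʳ a))))
           (≈-trans c≈0 (≈-reflexive (sym (ℤP.*-zeroʳ a)))) (≈-trans (≈-sym a≈d) (≈-reflexive (sym (ℤP.*-identityʳ a)))))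
      where
      b≈0 : b ≈ + 0
      b≈0 = x*y≈0⇒y≈0 a+d≉0 (≈-via (upper λ' a b d) (difference e₁₂))
      c≈0 : c ≈ + 0
      c≈0 = x*y≈0⇒y≈0 a+d≉0 (≈-via (lower λ' a c d) (difference e₂₁))
      a≈d : a ≈ d
      a≈d = [ (λ a≈d → a≈d) , (λ a≈-d → ⊥-elim (a+d≉0 (≈-via (trace a d) (difference a≈-d)))) ]′
              (x*x≈y*y⇒x≈y⊎x≈-y a d (≈-via (diagonal λ' a b c d) (difference e₁₁ ⊕ - + 1 ⊛ difference e₂₂)))
      a≉0 : a ≉ + 0
      a≉0 a≈0 = λ'≉0 (≈-via (λ'-identity λ' a b c) (- + 1 ⊛ difference e₁₁ ⊕ a ⊛ difference a≈0 ⊕ c ⊛ difference b≈0))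

  product-square : ∀ a b {λa λb σ} → a · a ≋ scal λa I₂ → b · b ≋ scal λb I₂ → b · a ≋ scal σ (a · b) →
                   a · b · (a · b) ≋ scal (σ * (λb * λa)) I₂
  product-square a b {λa} {λb} {σ} aa≋ bb≋ ba≋ = begin
    a · b · (a · b)                   ≡⟨ ·-assoc a b (a · b) ⟩
    a · (b · (a · b))                 ≡⟨ cong (a ·_) (sym (·-assoc b a b)) ⟩
    a · (b · a · b)                   ≈⟨ ·-congˡ a (·-congʳ b ba≋) ⟩
    a · (scal σ (a · b) · b)          ≡⟨ cong (a ·_) (trans (scal-·ˡ σ (a · b) b) (cong (scal σ) (·-assoc a b b))) ⟩
    a · scal σ (a · (b · b))          ≡⟨ scal-·ʳ σ a (a · (b · b)) ⟩
    scal σ (a · (a · (b · b)))        ≈⟨ scal-congʳ σ (·-congˡ a (·-congˡ a bb≋)) ⟩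
    scal σ (a · (a · scal λb I₂))     ≡⟨ cong (λ t → scal σ (a · t)) (·-scal-I λb a) ⟩
    scal σ (a · scal λb a)            ≡⟨ cong (scal σ) (scal-·ʳ λb a a) ⟩
    scal σ (scal λb (a · a))          ≈⟨ scal-congʳ σ (scal-congʳ λb aa≋) ⟩
    scal σ (scal λb (scal λa I₂))     ≡⟨ trans (cong (scal σ) (scal-scal λb λa I₂)) (scal-scal σ (λb * λa) I₂) ⟩
    scal (σ * (λb * λa)) I₂           ∎
    where open ≋-Reasoning

  -- What the three nontrivial elements a, b, ab of N = ⟨[a], [b]⟩ have in common.
  record KleinElement (a b m : Mat) : Set where
    field
      invertible : det m ≉ + 0
      trace-zero : TraceZero m
      a-commutes : ProjCommute a m
      b-commutes : ProjCommute b m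

  OneTwo-map : ∀ {P Q P' Q' : Mat → Set} a b → (∀ m → P m → P' m) → (∀ m → Q m → Q' m) →
               OneTwo P Q a b → OneTwo P' Q' a b
  OneTwo-map a b f g (inj₁ (pa , qb , qab)) = inj₁ (f a pa , g b qb , g (a · b) qab)
  OneTwo-map a b f g (inj₂ (inj₁ (qa , pb , qab))) = inj₂ (inj₁ (g a qa , f b pb , g (a · b) qab))
  OneTwo-map a b f g (inj₂ (inj₂ (qa , qb , pab))) = inj₂ (inj₂ (g a qa , g b qb , f (a · b) pab))

  forget-split : ∀ {a b} m → InSplitNorm p a b m → InSplit p m
  forget-split _ (g , g-inv , m∈C , _) = g , g-inv , m∈C

  forget-nonsplit : ∀ {a b} m → InNonSplitNorm p a b m → InNonSplit p m
  forget-nonsplit _ (ε , ε-nonsquare , g , g-inv , m∈C , _) = ε , ε-nonsquare , g , g-inv , m∈C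

  module N (a b : Mat) (klein : KleinFour p a b) where

    private
      a-inv : det a ≉ + 0
      a-inv = let (a-inv , _) = klein in nonZero⇒≉0 a-inv
      b-inv : det b ≉ + 0
      b-inv = let (_ , b-inv , _) = klein in nonZero⇒≉0 b-inv
      a≠1 : ¬ ProjEq p a I₂
      a≠1 = let (_ , _ , a≠1 , _) = klein in a≠1
      b≠1 : ¬ ProjEq p b I₂
      b≠1 = let (_ , _ , _ , b≠1 , _) = klein in b≠1
      ab≠1 : ¬ ProjEq p (a · b) I₂
      ab≠1 = let (_ , _ , _ , _ , ab≠1 , _) = klein in ab≠1
      a²=1 : ProjEq p (a · a) I₂
      a²=1 = let (_ , _ , _ , _ , _ , a²=1 , _) = klein in a²=1
      b²=1 : ProjEq p (b · b) I₂
      b²=1 = let (_ , _ , _ , _ , _ , _ , b²=1 , _) = klein in b²=1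
      ab=ba : ProjEq p (a · b) (b · a)
      ab=ba = let (_ , _ , _ , _ , _ , _ , _ , ab=ba) = klein in ab=ba
      λa = proj₁ a²=1
      λb = proj₁ b²=1
      λa≉0 : λa ≉ + 0
      λa≉0 = nonZero⇒≉0 (proj₁ (proj₂ a²=1))
      λb≉0 : λb ≉ + 0
      λb≉0 = nonZero⇒≉0 (proj₁ (proj₂ b²=1))
      aa≋ : a · a ≋ scal λa I₂
      aa≋ = ≋[mod]⇒≋ (proj₂ (proj₂ a²=1))
      bb≋ : b · b ≋ scal λb I₂
      bb≋ = ≋[mod]⇒≋ (proj₂ (proj₂ b²=1))
      a~b : ProjCommute a b
      a~b = proj₁ ab=ba , nonZero⇒≉0 {proj₁ ab=ba} (proj₁ (proj₂ ab=ba)) , ≋[mod]⇒≋ (proj₂ (proj₂ ab=ba))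
      b~a : ProjCommute b a
      b~a = projCommute-sym a b a~b
      ab-square : a · b · (a · b) ≋ scal (proj₁ b~a * (λb * λa)) I₂
      ab-square = product-square a b {λa} {λb} {proj₁ b~a} aa≋ bb≋ (proj₂ (proj₂ b~a))

    klein-a : KleinElement a b a
    klein-a = record
      { invertible = a-inv
      ; trace-zero = involution-trace-zero a λa λa≉0 aa≋ a≠1
      ; a-commutes = projCommute-refl a
      ; b-commutes = b~a }

    klein-b : KleinElement a b b
    klein-b = record
      { invertible = b-inv
      ; trace-zero = involution-trace-zero b λb λb≉0 bb≋ b≠1
      ; a-commutes = a~b
      ; b-commutes = projCommute-refl b }

    klein-ab : KleinElement a b (a · b)
    klein-ab = record
      { invertible = ≉0-resp (≈-reflexive (det-· a b)) (*-≉0 a-inv b-inv)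
      ; trace-zero = involution-trace-zero (a · b) (proj₁ b~a * (λb * λa)) (*-≉0 (proj₁ (proj₂ b~a)) (*-≉0 λb≉0 λa≉0))
                       ab-square ab≠1
      ; a-commutes = projCommute-·ʳ a a b (projCommute-refl a) a~b
      ; b-commutes = projCommute-·ʳ b a b b~a (projCommute-refl b) }

    split : ∀ {m} → KleinElement a b m → IsSquare (- det m) → InSplitNorm p a b m
    split {m} m∈N = split-normaliser a b m a-inv b-inv a-commutes b-commutes invertible trace-zero
      where open KleinElement m∈N

    nonsplit : ∀ {m} → KleinElement a b m → IsNonSquare (- det m) → InNonSplitNorm p a b m
    nonsplit {m} m∈N = nonsplit-normaliser a b m a-inv b-inv a-commutes b-commutes invertible trace-zero
      where open KleinElement m∈N

    split-if-square : p % 4 ≡ 1 → ∀ {m} → KleinElement a b m → IsSquare (det m) → InSplitNorm p a b m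
    split-if-square p≡1 {m} m∈N det-square =
      split m∈N (IsSquare-resp (-x≈-1*x (det m)) (square*square (-1-square p≡1) det-square))

    nonsplit-if-nonsquare : p % 4 ≡ 1 → ∀ {m} → KleinElement a b m → IsNonSquare (det m) → InNonSplitNorm p a b m
    nonsplit-if-nonsquare p≡1 {m} m∈N det-nonsquare =
      nonsplit m∈N (IsNonSquare-resp (-x≈-1*x (det m)) (square*nonsquare (-1-square p≡1) (-‿≉0 1≉0) det-nonsquare))

    nonsplit-if-square : p % 4 ≡ 3 → ∀ {m} → KleinElement a b m → IsSquare (det m) → InNonSplitNorm p a b m
    nonsplit-if-square p≡3 {m} m∈N det-square =
      nonsplit m∈N (IsNonSquare-resp (≈-trans (-x≈-1*x (det m)) (≈-reflexive (ℤP.*-comm (- + 1) (det m))))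
        (square*nonsquare det-square (KleinElement.invertible m∈N) (-1-nonsquare p≡3)))

    split-if-nonsquare : p % 4 ≡ 3 → ∀ {m} → KleinElement a b m → IsNonSquare (det m) → InSplitNorm p a b m
    split-if-nonsquare p≡3 {m} m∈N det-nonsquare =
      split m∈N (IsSquare-resp (-x≈-1*x (det m)) (nonsquare*nonsquare (-1-nonsquare p≡3) det-nonsquare))

    det-ab≈ : det (a · b) ≈ det a * det b
    det-ab≈ = ≈-reflexive (det-· a b)

    det-ab-square : IsSquare (det a) → IsSquare (det b) → IsSquare (det (a · b))
    det-ab-square □a □b = IsSquare-resp det-ab≈ (square*square □a □b)

    det-ab-nonsquareˡ : IsNonSquare (det a) → IsSquare (det b) → IsNonSquare (det (a · b))
    det-ab-nonsquareˡ a-nonsquare □b = IsNonSquare-resp (≈-trans det-ab≈ (≈-reflexive (ℤP.*-comm (det a) (det b))))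
                                        (square*nonsquare □b b-inv a-nonsquare)

    det-ab-nonsquareʳ : IsSquare (det a) → IsNonSquare (det b) → IsNonSquare (det (a · b))
    det-ab-nonsquareʳ □a b-nonsquare = IsNonSquare-resp det-ab≈ (square*nonsquare □a a-inv b-nonsquare)

    det-ab-square-nonsquares : IsNonSquare (det a) → IsNonSquare (det b) → IsSquare (det (a · b))
    det-ab-square-nonsquares a-nonsquare b-nonsquare = IsSquare-resp det-ab≈ (nonsquare*nonsquare a-nonsquare b-nonsquare)

    module _ {P Q : Mat → Set}
             (square⇒P : ∀ {m} → KleinElement a b m → IsSquare (det m) → P m)
             (nonsquare⇒Q : ∀ {m} → KleinElement a b m → IsNonSquare (det m) → Q m) where

      both-squares : SqDet p a × SqDet p b → P a × P b × P (a · b)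
      both-squares (a-square , b-square) =
        square⇒P klein-a □a , square⇒P klein-b □b , square⇒P klein-ab (det-ab-square □a □b)
        where
        □a : IsSquare (det a)
        □a = square[mod]⇒IsSquare a-square
        □b : IsSquare (det b)
        □b = square[mod]⇒IsSquare b-square

      not-both-squares : ¬ (SqDet p a × SqDet p b) → OneTwo P Q a b
      not-both-squares not-both = by-cases (IsSquare? (det a)) (IsSquare? (det b))
        where
        by-cases : Dec (IsSquare (det a)) → Dec (IsSquare (det b)) → OneTwo P Q a b
        by-cases (yes □a) (yes □b) = ⊥-elim (not-both (IsSquare⇒square[mod] □a , IsSquare⇒square[mod] □b))
        by-cases (yes □a) (no ¬□b) = inj₁
          (square⇒P klein-a □a , nonsquare⇒Q klein-b (b-inv , ¬□b) , nonsquare⇒Q klein-ab (det-ab-nonsquareʳ □a (b-inv , ¬□b)))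
        by-cases (no ¬□a) (yes □b) = inj₂ (inj₁
          (nonsquare⇒Q klein-a (a-inv , ¬□a) , square⇒P klein-b □b , nonsquare⇒Q klein-ab (det-ab-nonsquareˡ (a-inv , ¬□a) □b)))
        by-cases (no ¬□a) (no ¬□b) = inj₂ (inj₂
          (nonsquare⇒Q klein-a (a-inv , ¬□a) , nonsquare⇒Q klein-b (b-inv , ¬□b) ,
           square⇒P klein-ab (det-ab-square-nonsquares (a-inv , ¬□a) (b-inv , ¬□b))))

lemma2p7 : (p : ℕ) → Prime p → p ≢ 2 → (a b : Mat) → KleinFour p a b →
    ((SqDet p a × SqDet p b) →
        (p % 4 ≡ 1 → InSplitNorm p a b a × InSplitNorm p a b b × InSplitNorm p a b (a · b))
      × (p % 4 ≡ 3 → InNonSplitNorm p a b a × InNonSplitNorm p a b b × InNonSplitNorm p a b (a · b)))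
    × (¬ (SqDet p a × SqDet p b) →
        (p % 4 ≡ 1 → OneTwo (InSplit p) (InNonSplit p) a b)
      × (p % 4 ≡ 3 → OneTwo (InNonSplit p) (InSplit p) a b))
lemma2p7 p p-prime p≢2 a b klein =
    (λ both → (λ p≡1 → both-squares {Split} {NonSplit} (split-if-square p≡1) (nonsplit-if-nonsquare p≡1) both)
            , (λ p≡3 → both-squares {NonSplit} {Split} (nonsplit-if-square p≡3) (split-if-nonsquare p≡3) both))
  , (λ not-both → (λ p≡1 → forget-split-first (not-both-squares (split-if-square p≡1) (nonsplit-if-nonsquare p≡1) not-both))
                , (λ p≡3 → forget-nonsplit-first (not-both-squares (nonsplit-if-square p≡3) (split-if-nonsquare p≡3) not-both)))
  where
  open KleinFourSubgroups p p-prime p≢2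
  open N a b klein
  Split NonSplit : Mat → Set
  Split = InSplitNorm p a b
  NonSplit = InNonSplitNorm p a b
  forget-split-first : OneTwo Split NonSplit a b → OneTwo (InSplit p) (InNonSplit p) a b
  forget-split-first = OneTwo-map a b (forget-split {a} {b}) (forget-nonsplit {a} {b})
  forget-nonsplit-first : OneTwo NonSplit Split a b → OneTwo (InNonSplit p) (InSplit p) a b
  forget-nonsplit-first = OneTwo-map a b (forget-nonsplit {a} {b}) (forget-split {a} {b})
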